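{- Let $p$ be a prime. For all integers $n,m,k\geq 0$, $$A_{n+p^m+k,\,k}\equiv mA_{n+k,k}+A_{n+k+1,k}\pmod p.$$
   Context: A partition of a finite set is a collection of nonempty, pairwise disjoint subsets (blocks) whose union is the set; a singleton of a partition is a block with exactly one element. For integers $0\leq k\leq n$, $A_{n,k}$ denotes the number of partitions of $\{1,2,\dots,n+1\}$ whose largest singleton is $k+1$ (i.e. $\{k+1\}$ is a block and no $j>k+1$ forms a singleton block). -}

module Defs where

open import Data.Nat using (ℕ; zero; suc; _<_; _<?_)
open import Data.Bool using (Bool; true; false)
open import Data.Bool.Properties using () renaming (_≟_ to _≟ᵇ_)
open import Data.Fin using (Fin; zero; suc; toℕ)
open import Data.Fin.Properties using (all?; any?) renaming (_≟_ to _≟ᶠ_)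
open import Data.List using (List; []; _∷_; [_]; map; concatMap; filter; length)
open import Data.Product using (Σ; _×_; _,_)
open import Relation.Binary.PropositionalEquality using (_≡_)
open import Relation.Nullary using (Dec; ¬_; _×-dec_; _→-dec_; ¬?)
open import Data.Nat.Properties using () renaming (_≟_ to _≟ⁿ_)

-- All functions Fin n → A whose values are drawn from the given list
-- (with the full list of A this enumerates every function exactly once).
allFuns : ∀ {a} {A : Set a} (n : ℕ) → List A → List (Fin n → A)
allFuns zero    xs = [ (λ ()) ]
allFuns (suc n) xs =
  concatMap (λ x → map (λ f → λ { zero → x ; (suc i) → f i }) (allFuns n xs)) xs

allRelations : (N : ℕ) → List (Fin N → Fin N → Bool)
allRelations N = allFuns N (allFuns N (true ∷ false ∷ []))

-- A partition of the N-element set Fin N, given by its equivalence relation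
-- "i and j lie in the same block" (blocks = equivalence classes).
IsPartition : {N : ℕ} → (Fin N → Fin N → Bool) → Set
IsPartition {N} R =
  (∀ i → R i i ≡ true) ×
  (∀ i j → R i j ≡ true → R j i ≡ true) ×
  (∀ i j l → R i j ≡ true → R j l ≡ true → R i l ≡ true)

IsSingleton : {N : ℕ} → (Fin N → Fin N → Bool) → Fin N → Set
IsSingleton R i = ∀ j → R i j ≡ true → j ≡ i

-- The largest singleton of R is the element with (0-based) index k,
-- i.e. element k+1 of {1,…,N}.
LargestSingletonIs : {N : ℕ} → (Fin N → Fin N → Bool) → ℕ → Set
LargestSingletonIs {N} R k =
  Σ (Fin N) (λ i → toℕ i ≡ k × IsSingleton R i) ×
  (∀ j → k < toℕ j → ¬ IsSingleton R j)

isPartition? : {N : ℕ} → (R : Fin N → Fin N → Bool) → Dec (IsPartition R)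
isPartition? R =
  all? (λ i → R i i ≟ᵇ true) ×-dec
  (all? (λ i → all? (λ j → (R i j ≟ᵇ true) →-dec (R j i ≟ᵇ true))) ×-dec
   all? (λ i → all? (λ j → all? (λ l →
     (R i j ≟ᵇ true) →-dec ((R j l ≟ᵇ true) →-dec (R i l ≟ᵇ true))))))

isSingleton? : {N : ℕ} → (R : Fin N → Fin N → Bool) → (i : Fin N) → Dec (IsSingleton R i)
isSingleton? R i = all? (λ j → (R i j ≟ᵇ true) →-dec (j ≟ᶠ i))

largestSingletonIs? : {N : ℕ} → (R : Fin N → Fin N → Bool) → (k : ℕ) → Dec (LargestSingletonIs R k)
largestSingletonIs? R k =
  any? (λ i → (toℕ i ≟ⁿ k) ×-dec isSingleton? R i) ×-dec
  all? (λ j → (k <? toℕ j) →-dec ¬? (isSingleton? R j))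

-- A n k = number of partitions of {1,…,n+1} whose largest singleton is k+1.
A : ℕ → ℕ → ℕ
A n k = length (filter (λ R → isPartition? R ×-dec largestSingletonIs? R k)
                       (allRelations (suc n)))

-- Write aₖ(N) = A(N + k, k). Splitting on whether the first element is a singleton gives
-- aₖ₊₁(N) = aₖ(N) + aₖ(N + 1), and aₖ(0) = A(k, k) is the Bell number Bₖ, so aₖ(N) = (ΔᴺB)(k) for the
-- forward difference Δ = E − 1. The Stirling numbers satisfy S(n + p, b) ≡ S(n, b − p) + S(n + 1, b)
-- modulo p (by k! S(n, k) = Δᵏxⁿ(0) and Fermat), which sums to Touchard's congruence
-- B(n + p) ≡ B(n) + B(n + 1); as Δᵖ ≡ Eᵖ − 1 it passes to every aₖ: aₖ(N + p) ≡ aₖ(N) + aₖ(N + 1).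
-- Finally, by induction on m a step of pᵐ acts on aₖ as E + m, because
-- (E + m)ᵖ ≡ Eᵖ + mᵖ ≡ E + 1 + m modulo p.

module Submission where

module BinomialExpansion where

  open import Data.Nat as ℕ using (ℕ; zero; suc; _∸_; _≤_; _<_; z≤n; s≤s)
  import Data.Nat.Properties as ℕₚ
  open import Data.Nat.Combinatorics using (_C_; k>n⇒nCk≡0; nCk+nC[k+1]≡[n+1]C[k+1])
  open import Data.Integer using (ℤ; +_; _+_; _*_; _^_)
  import Data.Integer.Properties as ℤₚ
  open import Data.Integer.Tactic.RingSolver using (solve-∀)
  open import Relation.Binary.PropositionalEquality
  open import Data.Sum using (inj₁; inj₂)

  sumTo : ℕ → (ℕ → ℤ) → ℤ
  sumTo zero    f = + 0
  sumTo (suc n) f = f 0 + sumTo n (λ j → f (suc j))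

  sumTo-cong : ∀ n {f g : ℕ → ℤ} → (∀ j → f j ≡ g j) → sumTo n f ≡ sumTo n g
  sumTo-cong zero    eq = refl
  sumTo-cong (suc n) eq = cong₂ _+_ (eq 0) (sumTo-cong n (λ j → eq (suc j)))

  sumTo-sucʳ : ∀ n (f : ℕ → ℤ) → sumTo (suc n) f ≡ sumTo n f + f n
  sumTo-sucʳ zero    f = trans (ℤₚ.+-identityʳ (f 0)) (sym (ℤₚ.+-identityˡ (f 0)))
  sumTo-sucʳ (suc n) f = trans (cong (_+_ (f 0)) (sumTo-sucʳ n (λ j → f (suc j))))
                               (sym (ℤₚ.+-assoc (f 0) _ _))

  sumTo-distrib-+ : ∀ n (f g : ℕ → ℤ) → sumTo n (λ j → f j + g j) ≡ sumTo n f + sumTo n g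
  sumTo-distrib-+ zero    f g = refl
  sumTo-distrib-+ (suc n) f g =
    trans (cong (_+_ (f 0 + g 0)) (sumTo-distrib-+ n (λ j → f (suc j)) (λ j → g (suc j))))
          (interchange (f 0) (g 0) _ _)
    where
    interchange : ∀ a b x y → (a + b) + (x + y) ≡ (a + x) + (b + y)
    interchange = solve-∀

  sumTo-distribˡ-* : ∀ n c (f : ℕ → ℤ) → sumTo n (λ j → c * f j) ≡ c * sumTo n f
  sumTo-distribˡ-* zero    c f = sym (ℤₚ.*-zeroʳ c)
  sumTo-distribˡ-* (suc n) c f = trans (cong (_+_ (c * f 0)) (sumTo-distribˡ-* n c (λ j → f (suc j))))
                                       (sym (ℤₚ.*-distribˡ-+ c (f 0) _))

  sumTo-zero : ∀ n (f : ℕ → ℤ) → (∀ j → f j ≡ + 0) → sumTo n f ≡ + 0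
  sumTo-zero zero    f f≡0 = refl
  sumTo-zero (suc n) f f≡0 = cong₂ _+_ (f≡0 0) (sumTo-zero n (λ j → f (suc j)) (λ j → f≡0 (suc j)))

  sumTo-vanishing-tail : ∀ a q (f : ℕ → ℤ) → (∀ j → a ≤ j → f j ≡ + 0) → sumTo (a ℕ.+ q) f ≡ sumTo a f
  sumTo-vanishing-tail zero    q f f≡0 = sumTo-zero q f (λ j → f≡0 j z≤n)
  sumTo-vanishing-tail (suc a) q f f≡0 =
    cong (_+_ (f 0)) (sumTo-vanishing-tail a q (λ j → f (suc j)) (λ j a≤j → f≡0 (suc j) (s≤s a≤j)))

  -- ([E+ c ]^ r) s = (E + c)ʳ s for the shift (E s) k = s (suc k); coeff c r j is the coefficient of Eʲ.
  [E+_]^_ : ℤ → ℕ → (ℕ → ℤ) → ℕ → ℤ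
  ([E+ c ]^ zero)  s k = s k
  ([E+ c ]^ suc r) s k = ([E+ c ]^ r) s (suc k) + c * ([E+ c ]^ r) s k

  coeff : ℤ → ℕ → ℕ → ℤ
  coeff c r j = + (r C j) * c ^ (r ∸ j)

  coeff-vanishes : ∀ c {r j} → r < j → coeff c r j ≡ + 0
  coeff-vanishes c {r} {j} r<j = cong (λ n → + n * c ^ (r ∸ j)) (k>n⇒nCk≡0 r<j)

  coeff-pascal : ∀ c r j → coeff c r j + c * coeff c r (suc j) ≡ coeff c (suc r) (suc j)
  coeff-pascal c r j = begin
    coeff c r j + c * coeff c r (suc j)
      ≡⟨ cong (_+_ (coeff c r j)) (sym shifted) ⟩
    + (r C j) * c ^ (r ∸ j) + + (r C suc j) * c ^ (r ∸ j)
      ≡⟨ sym (ℤₚ.*-distribʳ-+ (c ^ (r ∸ j)) (+ (r C j)) (+ (r C suc j))) ⟩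
    (+ (r C j) + + (r C suc j)) * c ^ (r ∸ j)
      ≡⟨ cong (λ n → n * c ^ (r ∸ j)) (sym (ℤₚ.pos-+ (r C j) (r C suc j))) ⟩
    + (r C j ℕ.+ r C suc j) * c ^ (r ∸ j)
      ≡⟨ cong (λ n → + n * c ^ (r ∸ j)) (nCk+nC[k+1]≡[n+1]C[k+1] r j) ⟩
    coeff c (suc r) (suc j) ∎
    where
    open ≡-Reasoning
    shifted : + (r C suc j) * c ^ (r ∸ j) ≡ c * coeff c r (suc j)
    shifted with ℕₚ.<-≤-connex j r
    ... | inj₁ j<r = begin
      + (r C suc j) * c ^ (r ∸ j)             ≡⟨ cong (λ e → + (r C suc j) * c ^ e) (ℕₚ.+-∸-assoc 1 j<r) ⟩
      + (r C suc j) * (c * c ^ (r ∸ suc j))   ≡⟨ x*[c*y]≡c*[x*y] (+ (r C suc j)) c _ ⟩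
      c * coeff c r (suc j)                   ∎
      where
      x*[c*y]≡c*[x*y] : ∀ x c y → x * (c * y) ≡ c * (x * y)
      x*[c*y]≡c*[x*y] = solve-∀
    ... | inj₂ r≤j = begin
      + (r C suc j) * c ^ (r ∸ j)  ≡⟨ cong (λ n → + n * c ^ (r ∸ j)) (k>n⇒nCk≡0 (s≤s r≤j)) ⟩
      + 0                          ≡⟨ sym (ℤₚ.*-zeroʳ c) ⟩
      c * + 0                      ≡⟨ cong (c *_) (sym (coeff-vanishes c (s≤s r≤j))) ⟩
      c * coeff c r (suc j)        ∎

  [E+]^-expand : ∀ c r s k → ([E+ c ]^ r) s k ≡ sumTo (suc r) (λ j → coeff c r j * s (k ℕ.+ j))
  [E+]^-expand c zero s k = sym (begin
    (+ 1 * + 1) * s (k ℕ.+ 0) + + 0  ≡⟨ cong (λ i → (+ 1 * + 1) * s i + + 0) (ℕₚ.+-identityʳ k) ⟩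
    (+ 1 * + 1) * s k + + 0          ≡⟨ unit (s k) ⟩
    s k                              ∎)
    where
    open ≡-Reasoning
    unit : ∀ x → (+ 1 * + 1) * x + + 0 ≡ x
    unit = solve-∀
  [E+]^-expand c (suc r) s k = begin
    F + c * G
      ≡⟨ cong₂ (λ a b → a + c * b) ([E+]^-expand c r s (suc k)) ([E+]^-expand c r s k) ⟩
    ∑F + c * (t 0 + sumTo r (λ j → t (suc j))) ≡⟨ cong (λ z → ∑F + c * (t 0 + z)) drop-last ⟩
    ∑F + c * (t 0 + ∑T)                      ≡⟨ rearrange ∑F c (t 0) ∑T ⟩
    c * t 0 + (∑F + c * ∑T)                  ≡⟨ cong₂ _+_ first-term merge ⟩
    h₀ + sumTo (suc r) (λ j → u j + c * t (suc j))
                                             ≡⟨ cong (_+_ h₀) (sumTo-cong (suc r) term) ⟩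
    h₀ + sumTo (suc r) (λ j → coeff c (suc r) (suc j) * s (k ℕ.+ suc j)) ∎
    where
    open ≡-Reasoning
    F = ([E+ c ]^ r) s (suc k)
    G = ([E+ c ]^ r) s k
    t u : ℕ → ℤ
    t j = coeff c r j * s (k ℕ.+ j)
    u j = coeff c r j * s (suc k ℕ.+ j)
    ∑F = sumTo (suc r) u
    ∑T = sumTo (suc r) (λ j → t (suc j))
    h₀ = coeff c (suc r) 0 * s (k ℕ.+ 0)
    drop-last : sumTo r (λ j → t (suc j)) ≡ ∑T
    drop-last = sym (begin
      ∑T                                    ≡⟨ sumTo-sucʳ r (λ j → t (suc j)) ⟩
      sumTo r (λ j → t (suc j)) + t (suc r) ≡⟨ cong (λ z → sumTo r (λ j → t (suc j)) + z * s (k ℕ.+ suc r))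
                                                     (coeff-vanishes c (ℕₚ.n<1+n r)) ⟩
      sumTo r (λ j → t (suc j)) + + 0       ≡⟨ ℤₚ.+-identityʳ _ ⟩
      sumTo r (λ j → t (suc j))             ∎)
    rearrange : ∀ f c a g → f + c * (a + g) ≡ c * a + (f + c * g)
    rearrange = solve-∀
    first-term : c * t 0 ≡ h₀
    first-term = assoc c (c ^ r) (s (k ℕ.+ 0))
      where
      assoc : ∀ c x y → c * (+ 1 * x * y) ≡ + 1 * (c * x) * y
      assoc = solve-∀
    merge : ∑F + c * ∑T ≡ sumTo (suc r) (λ j → u j + c * t (suc j))
    merge = trans (cong (_+_ ∑F) (sym (sumTo-distribˡ-* (suc r) c (λ j → t (suc j)))))
                  (sym (sumTo-distrib-+ (suc r) u (λ j → c * t (suc j))))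
    term : ∀ j → u j + c * t (suc j) ≡ coeff c (suc r) (suc j) * s (k ℕ.+ suc j)
    term j = begin
      coeff c r j * s (suc k ℕ.+ j) + c * (coeff c r (suc j) * Y)
        ≡⟨ cong (λ i → coeff c r j * s i + c * (coeff c r (suc j) * Y)) (sym (ℕₚ.+-suc k j)) ⟩
      coeff c r j * Y + c * (coeff c r (suc j) * Y)  ≡⟨ factor (coeff c r j) c (coeff c r (suc j)) Y ⟩
      (coeff c r j + c * coeff c r (suc j)) * Y      ≡⟨ cong (_* Y) (coeff-pascal c r j) ⟩
      coeff c (suc r) (suc j) * Y                    ∎
      where
      Y = s (k ℕ.+ suc j)
      factor : ∀ a c b y → a * y + c * (b * y) ≡ (a + c * b) * y
      factor = solve-∀

  [E+]^-const : ∀ c r k → ([E+ c ]^ r) (λ _ → + 1) k ≡ (+ 1 + c) ^ r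
  [E+]^-const c zero    k = refl
  [E+]^-const c (suc r) k =
    trans (cong₂ (λ a b → a + c * b) ([E+]^-const c r (suc k)) ([E+]^-const c r k)) (factor c ((+ 1 + c) ^ r))
    where
    factor : ∀ c x → x + c * x ≡ (+ 1 + c) * x
    factor = solve-∀

module Congruence where

  open BinomialExpansion
  open import Level using (0ℓ)
  open import Data.Nat as ℕ using (ℕ; zero; suc; _∸_; _<_; z≤n; s≤s; _!)
  import Data.Nat.Properties as ℕₚ
  import Data.Nat.Divisibility as ℕ
  open import Data.Nat.Primality using (Prime; euclidsLemma; prime⇒nonTrivial)
  open import Data.Nat.Combinatorics using (_C_; nCn≡1; nCk≡n!/k![n-k]!; k![n∸k]!∣n!)
  open import Data.Nat.DivMod using (m/n*n≡m)
  open import Data.Integer using (ℤ; +_; -_; -1ℤ; _+_; _-_; _*_; _^_; ∣_∣)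
  import Data.Integer.Properties as ℤₚ
  open import Data.Integer.Divisibility.Signed
  open import Data.Integer.Tactic.RingSolver using (solve-∀)
  open import Data.Sum using (inj₁; inj₂)
  open import Data.Empty using (⊥-elim)
  open import Relation.Nullary using (¬_)
  open import Relation.Binary.Bundles using (Setoid)
  open import Relation.Binary.Structures using (IsEquivalence)
  import Relation.Binary.Reasoning.Setoid as SetoidReasoning
  open import Relation.Binary.PropositionalEquality

  module Modulo (m : ℕ) where

    -- A record rather than a definition, so that x and y can be inferred from a proof of x ≈ y.
    infix 4 _≈_
    record _≈_ (x y : ℤ) : Set where
      constructor mk≈
      field divides-difference : + m ∣ x - y
    open _≈_ public

    private
      transport : ∀ {x y} → x ≡ y → + m ∣ x → + m ∣ y
      transport = subst (+ m ∣_)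

    ≡⇒≈ : ∀ {x y} → x ≡ y → x ≈ y
    ≡⇒≈ {x} refl = mk≈ (transport (sym (ℤₚ.+-inverseʳ x)) (divides (+ 0) refl))

    ≈-sym : ∀ {x y} → x ≈ y → y ≈ x
    ≈-sym {x} {y} (mk≈ m∣x-y) = mk≈ (transport (negate x y) (∣m⇒∣-m m∣x-y))
      where
      negate : ∀ x y → - (x - y) ≡ y - x
      negate = solve-∀

    ≈-trans : ∀ {x y z} → x ≈ y → y ≈ z → x ≈ z
    ≈-trans {x} {y} {z} (mk≈ m∣x-y) (mk≈ m∣y-z) = mk≈ (transport (telescope x y z) (∣m∣n⇒∣m+n m∣x-y m∣y-z))
      where
      telescope : ∀ x y z → (x - y) + (y - z) ≡ x - z
      telescope = solve-∀

    ≈-isEquivalence : IsEquivalence _≈_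
    ≈-isEquivalence = record { refl = ≡⇒≈ refl ; sym = ≈-sym ; trans = ≈-trans }

    ≈-setoid : Setoid 0ℓ 0ℓ
    ≈-setoid = record { isEquivalence = ≈-isEquivalence }

    open IsEquivalence ≈-isEquivalence public using () renaming (refl to ≈-refl)

    module ≈-Reasoning = SetoidReasoning ≈-setoid

    +-cong : ∀ {x y u v} → x ≈ y → u ≈ v → x + u ≈ y + v
    +-cong {x} {y} {u} {v} (mk≈ m∣x-y) (mk≈ m∣u-v) = mk≈ (transport (regroup x y u v) (∣m∣n⇒∣m+n m∣x-y m∣u-v))
      where
      regroup : ∀ x y u v → (x - y) + (u - v) ≡ (x + u) - (y + v)
      regroup = solve-∀

    -‿cong : ∀ {x y u v} → x ≈ y → u ≈ v → x - u ≈ y - v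
    -‿cong {x} {y} {u} {v} (mk≈ m∣x-y) (mk≈ m∣u-v) = mk≈ (transport (regroup x y u v) (∣m∣n⇒∣m-n m∣x-y m∣u-v))
      where
      regroup : ∀ x y u v → (x - y) - (u - v) ≡ (x - u) - (y - v)
      regroup = solve-∀

    *-congˡ : ∀ c {x y} → x ≈ y → c * x ≈ c * y
    *-congˡ c {x} {y} (mk≈ m∣x-y) = mk≈ (transport (*-distribˡ-- c x y) (∣n⇒∣m*n c m∣x-y))
      where
      *-distribˡ-- : ∀ c x y → c * (x - y) ≡ c * x - c * y
      *-distribˡ-- = solve-∀

    *-congʳ : ∀ c {x y} → x ≈ y → x * c ≈ y * c
    *-congʳ c {x} {y} x≈y = ≈-trans (≡⇒≈ (ℤₚ.*-comm x c)) (≈-trans (*-congˡ c x≈y) (≡⇒≈ (ℤₚ.*-comm c y)))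

    ∣⇒≈0 : ∀ {x} → + m ∣ x → x ≈ + 0
    ∣⇒≈0 {x} m∣x = mk≈ (transport (sym (ℤₚ.+-identityʳ x)) m∣x)

    m*x≈0 : ∀ x → + m * x ≈ + 0
    m*x≈0 x = ∣⇒≈0 (∣m⇒∣m*n x (∣-refl {+ m}))

    m∣n⇒n*x≈0 : ∀ {n} → m ℕ.∣ n → ∀ x → + n * x ≈ + 0
    m∣n⇒n*x≈0 {n} (ℕ.divides q n≡q*m) x = ∣⇒≈0 (subst (λ n → + m ∣ + n * x) (sym n≡q*m)
      (subst (+ m ∣_) (sym (trans (cong (_* x) (ℤₚ.pos-* q m)) (ℤₚ.*-assoc (+ q) (+ m) x)))
        (∣n⇒∣m*n (+ q) (∣m⇒∣m*n x (∣-refl {+ m})))))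

    sumTo-cong≈ : ∀ n {f g : ℕ → ℤ} → (∀ j → f j ≈ g j) → sumTo n f ≈ sumTo n g
    sumTo-cong≈ zero    f≈g = ≈-refl
    sumTo-cong≈ (suc n) f≈g = +-cong (f≈g 0) (sumTo-cong≈ n (λ j → f≈g (suc j)))

    sumTo≈0 : ∀ n {f : ℕ → ℤ} → (∀ j → j < n → f j ≈ + 0) → sumTo n f ≈ + 0
    sumTo≈0 zero    f≈0 = ≈-refl
    sumTo≈0 (suc n) f≈0 = +-cong (f≈0 0 (s≤s z≤n)) (sumTo≈0 n (λ j j<n → f≈0 (suc j) (s≤s j<n)))

    sumTo-ends : ∀ {n} → 0 < n → (f : ℕ → ℤ) → (∀ j → 0 < j → j < n → f j ≈ + 0) →
                 sumTo (suc n) f ≈ f 0 + f n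
    sumTo-ends {suc n} _ f f≈0 = +-cong (≈-refl {f 0}) (begin
      sumTo (suc n) (λ j → f (suc j))        ≡⟨ sumTo-sucʳ n (λ j → f (suc j)) ⟩
      sumTo n (λ j → f (suc j)) + f (suc n)  ≈⟨ +-cong (sumTo≈0 n (λ j j<n → f≈0 (suc j) (s≤s z≤n) (s≤s j<n))) ≈-refl ⟩
      + 0 + f (suc n)                        ≡⟨ ℤₚ.+-identityˡ (f (suc n)) ⟩
      f (suc n)                              ∎)
      where open ≈-Reasoning

    [E+]^-cong≈ : ∀ c r {s s′ : ℕ → ℤ} → (∀ j → s j ≈ s′ j) → ∀ k → ([E+ c ]^ r) s k ≈ ([E+ c ]^ r) s′ k
    [E+]^-cong≈ c zero    s≈s′ k = s≈s′ k
    [E+]^-cong≈ c (suc r) s≈s′ k = +-cong ([E+]^-cong≈ c r s≈s′ (suc k)) (*-congˡ c ([E+]^-cong≈ c r s≈s′ k))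

  0^n≡0 : ∀ {n} → 0 < n → (+ 0) ^ n ≡ + 0
  0^n≡0 {suc n} _ = ℤₚ.*-zeroˡ ((+ 0) ^ n)

  n∣n! : ∀ n → .{{ℕ.NonZero n}} → n ℕ.∣ n !
  n∣n! (suc n) = ℕ.m∣m*n (n !)

  module _ {p : ℕ} (prime : Prime p) where

    open Modulo p

    private
      instance
        p-nonTrivial = prime⇒nonTrivial prime
        p-nonZero    = ℕ.nonTrivial⇒nonZero p

      0<p : 0 < p
      0<p = ℕ.>-nonZero⁻¹ p

    p∤k! : ∀ {k} → k < p → ¬ p ℕ.∣ k !
    p∤k! {zero}  _   p∣1   = ℕ.nonTrivial⇒≢1 (ℕ.∣1⇒≡1 p∣1)
    p∤k! {suc k} k<p p∣k! with euclidsLemma (suc k) (k !) prime p∣k!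
    ... | inj₁ p∣1+k = ℕₚ.<⇒≱ k<p (ℕ.∣⇒≤ p∣1+k)
    ... | inj₂ p∣k!  = p∤k! (ℕₚ.<-trans (ℕₚ.n<1+n k) k<p) p∣k!

    p∣pCj : ∀ {j} → 0 < j → j < p → p ℕ.∣ p C j
    p∣pCj {j} 0<j j<p with euclidsLemma (p C j) (j ! ℕ.* (p ∸ j) !) prime p∣product
      where
      pCj*j![p-j]!≡p! : (p C j) ℕ.* (j ! ℕ.* (p ∸ j) !) ≡ p !
      pCj*j![p-j]!≡p! = trans (cong (ℕ._* (j ! ℕ.* (p ∸ j) !)) (nCk≡n!/k![n-k]! (ℕₚ.<⇒≤ j<p)))
                              (m/n*n≡m {{j ℕₚ.!* (p ∸ j) !≢0}} (k![n∸k]!∣n! (ℕₚ.<⇒≤ j<p)))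
      p∣product : p ℕ.∣ (p C j) ℕ.* (j ! ℕ.* (p ∸ j) !)
      p∣product = subst (p ℕ.∣_) (sym pCj*j![p-j]!≡p!) (n∣n! p)
    ... | inj₁ p∣pCj = p∣pCj
    ... | inj₂ p∣j![p-j]! with euclidsLemma (j !) ((p ∸ j) !) prime p∣j![p-j]!
    ...   | inj₁ p∣j!     = ⊥-elim (p∤k! j<p p∣j!)
    ...   | inj₂ p∣[p-j]! = ⊥-elim (p∤k! (ℕₚ.∸-monoʳ-< 0<j (ℕₚ.<⇒≤ j<p)) p∣[p-j]!)

    *-cancelˡ-≈ : ∀ f {x y} → ¬ p ℕ.∣ f → + f * x ≈ + f * y → x ≈ y
    *-cancelˡ-≈ f {x} {y} p∤f (mk≈ p∣fx-fy) with euclidsLemma f ∣ x - y ∣ prime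
      (subst (p ℕ.∣_) (ℤₚ.abs-* (+ f) (x - y)) (∣⇒∣ᵤ (subst (+ p ∣_) (factor (+ f) x y) p∣fx-fy)))
      where
      factor : ∀ f x y → f * x - f * y ≡ f * (x - y)
      factor = solve-∀
    ... | inj₁ p∣f   = ⊥-elim (p∤f p∣f)
    ... | inj₂ p∣x-y = mk≈ (∣ᵤ⇒∣ p∣x-y)

    [E+c]^p≈E^p+c^p : ∀ c s k → ([E+ c ]^ p) s k ≈ s (k ℕ.+ p) + c ^ p * s k
    [E+c]^p≈E^p+c^p c s k = begin
      ([E+ c ]^ p) s k                 ≡⟨ [E+]^-expand c p s k ⟩
      sumTo (suc p) t                  ≈⟨ sumTo-ends 0<p t inner-terms ⟩
      t 0 + t p                        ≡⟨ cong₂ _+_ first last ⟩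
      c ^ p * s k + s (k ℕ.+ p)        ≡⟨ ℤₚ.+-comm (c ^ p * s k) (s (k ℕ.+ p)) ⟩
      s (k ℕ.+ p) + c ^ p * s k        ∎
      where
      open ≈-Reasoning
      t : ℕ → ℤ
      t j = coeff c p j * s (k ℕ.+ j)
      inner-terms : ∀ j → 0 < j → j < p → t j ≈ + 0
      inner-terms j 0<j j<p = ≈-trans (≡⇒≈ (ℤₚ.*-assoc (+ (p C j)) _ _)) (m∣n⇒n*x≈0 (p∣pCj 0<j j<p) _)
      first : t 0 ≡ c ^ p * s k
      first = cong₂ _*_ (ℤₚ.*-identityˡ (c ^ p)) (cong s (ℕₚ.+-identityʳ k))
      unit : ∀ x → + 1 * + 1 * x ≡ x
      unit = solve-∀
      last : t p ≡ s (k ℕ.+ p)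
      last = trans (cong₂ (λ n e → + n * c ^ e * s (k ℕ.+ p)) (nCn≡1 p) (ℕₚ.n∸n≡0 p)) (unit (s (k ℕ.+ p)))

    [1+c]^p≈1+c^p : ∀ c → (+ 1 + c) ^ p ≈ + 1 + c ^ p
    [1+c]^p≈1+c^p c = begin
      (+ 1 + c) ^ p                               ≡⟨ [E+]^-const c p 0 ⟨
      ([E+ c ]^ p) (λ _ → + 1) 0                   ≈⟨ [E+c]^p≈E^p+c^p c (λ _ → + 1) 0 ⟩
      + 1 + c ^ p * + 1                           ≡⟨ cong (_+_ (+ 1)) (ℤₚ.*-identityʳ (c ^ p)) ⟩
      + 1 + c ^ p                                 ∎
      where open ≈-Reasoning

    i^p≈i : ∀ i → (+ i) ^ p ≈ + i
    i^p≈i zero    = ≡⇒≈ (0^n≡0 0<p)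
    i^p≈i (suc i) = ≈-trans ([1+c]^p≈1+c^p (+ i)) (+-cong (≈-refl {+ 1}) (i^p≈i i))

    -1^p≈-1 : -1ℤ ^ p ≈ -1ℤ
    -1^p≈-1 = begin
      -1ℤ ^ p                   ≡⟨ add-and-subtract (-1ℤ ^ p) ⟩
      (+ 1 + -1ℤ ^ p) - + 1     ≈⟨ -‿cong ([1+c]^p≈1+c^p -1ℤ) ≈-refl ⟨
      (+ 1 + -1ℤ) ^ p - + 1     ≡⟨ cong (_- + 1) (0^n≡0 0<p) ⟩
      -1ℤ                       ∎
      where
      open ≈-Reasoning
      add-and-subtract : ∀ x → x ≡ (+ 1 + x) - + 1
      add-and-subtract = solve-∀

module Touchard where

  open BinomialExpansion
  open Congruence
  open import Data.Nat as ℕ using (ℕ; zero; suc; _∸_; _≤_; _<_; z≤n; s≤s; _!)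
  import Data.Nat.Properties as ℕₚ
  import Data.Nat.Tactic.RingSolver as ℕ-Solver
  open import Data.Nat.Primality using (Prime; prime⇒nonTrivial)
  open import Data.Integer using (ℤ; +_; -1ℤ; _+_; _*_; _^_)
  import Data.Integer.Properties as ℤₚ
  open import Data.Integer.Tactic.RingSolver using (solve-∀)
  open import Data.Sum using (inj₁; inj₂)
  open import Relation.Binary.PropositionalEquality
  open import Relation.Binary.Definitions using (tri<; tri≈; tri>)

  Δ : ℕ → (ℕ → ℤ) → ℕ → ℤ
  Δ = [E+ -1ℤ ]^_

  Δ-leibniz : ∀ k i (s : ℕ → ℤ) →
              Δ (suc k) (λ j → + j * s j) i ≡ (+ i + + suc k) * Δ (suc k) s i + + suc k * Δ k s i
  Δ-leibniz zero    i s = identity (+ i) (s (suc i)) (s i)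
    where
    identity : ∀ I a b → (+ 1 + I) * a + -1ℤ * (I * b) ≡ (I + + 1) * (a + -1ℤ * b) + + 1 * b
    identity = solve-∀
  Δ-leibniz (suc k) i s = begin
    Δ (suc k) (λ j → + j * s j) (suc i) + -1ℤ * Δ (suc k) (λ j → + j * s j) i
      ≡⟨ cong₂ (λ x y → x + -1ℤ * y) (Δ-leibniz k (suc i) s) (Δ-leibniz k i s) ⟩
    ((+ suc i + + suc k) * a + + suc k * c) + -1ℤ * ((+ i + + suc k) * (c + -1ℤ * d) + + suc k * d)
      ≡⟨ identity (+ i) (+ k) a c d ⟩
    (+ i + + suc (suc k)) * (a + -1ℤ * (c + -1ℤ * d)) + + suc (suc k) * (c + -1ℤ * d) ∎
    where
    open ≡-Reasoning
    a = Δ (suc k) s (suc i)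
    c = Δ k s (suc i)
    d = Δ k s i
    -- + suc n and + 1 + + n are definitionally equal, so the coefficients fit the solver's normal forms.
    identity : ∀ I K a c d →
      (((+ 1 + I) + (+ 1 + K)) * a + (+ 1 + K) * c) + -1ℤ * ((I + (+ 1 + K)) * (c + -1ℤ * d) + (+ 1 + K) * d)
      ≡ (I + (+ 1 + (+ 1 + K))) * (a + -1ℤ * (c + -1ℤ * d)) + (+ 1 + (+ 1 + K)) * (c + -1ℤ * d)
    identity = solve-∀

  stirling₂ : ℕ → ℕ → ℕ
  stirling₂ zero    zero    = 1
  stirling₂ zero    (suc k) = 0
  stirling₂ (suc n) zero    = 0
  stirling₂ (suc n) (suc k) = stirling₂ n k ℕ.+ suc k ℕ.* stirling₂ n (suc k)

  stirling₂-vanishes : ∀ {n k} → n < k → stirling₂ n k ≡ 0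
  stirling₂-vanishes {zero}  {suc k} _         = refl
  stirling₂-vanishes {suc n} {suc k} (s≤s n<k) =
    cong₂ ℕ._+_ (stirling₂-vanishes n<k)
                (trans (cong (suc k ℕ.*_) (stirling₂-vanishes (ℕₚ.m<n⇒m<1+n n<k))) (ℕₚ.*-zeroʳ (suc k)))

  stirling₂-diag : ∀ n → stirling₂ n n ≡ 1
  stirling₂-diag zero    = refl
  stirling₂-diag (suc n) =
    cong₂ ℕ._+_ (stirling₂-diag n)
                (trans (cong (suc n ℕ.*_) (stirling₂-vanishes (ℕₚ.n<1+n n))) (ℕₚ.*-zeroʳ (suc n)))

  k!*stirling₂≡Δᵏxⁿ : ∀ n k → + (k ! ℕ.* stirling₂ n k) ≡ Δ k (λ j → (+ j) ^ n) 0
  k!*stirling₂≡Δᵏxⁿ zero    zero    = refl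
  k!*stirling₂≡Δᵏxⁿ zero    (suc k) = trans (cong +_ (ℕₚ.*-zeroʳ (suc k !))) (sym ([E+]^-const -1ℤ (suc k) 0))
  k!*stirling₂≡Δᵏxⁿ (suc n) zero    = refl
  k!*stirling₂≡Δᵏxⁿ (suc n) (suc k) = sym (begin
    Δ (suc k) (λ j → + j * (+ j) ^ n) 0
      ≡⟨ Δ-leibniz k 0 (λ j → (+ j) ^ n) ⟩
    + suc k * Δ (suc k) xⁿ 0 + + suc k * Δ k xⁿ 0
      ≡⟨ cong₂ (λ x y → + suc k * x + + suc k * y) (sym (k!*stirling₂≡Δᵏxⁿ n (suc k))) (sym (k!*stirling₂≡Δᵏxⁿ n k)) ⟩
    + suc k * + (suc k ! ℕ.* S[n,k+1]) + + suc k * + (k ! ℕ.* S[n,k])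
      ≡⟨ cong₂ _+_ (sym (ℤₚ.pos-* (suc k) (suc k ! ℕ.* S[n,k+1]))) (sym (ℤₚ.pos-* (suc k) (k ! ℕ.* S[n,k]))) ⟩
    + (suc k ℕ.* (suc k ! ℕ.* S[n,k+1])) + + (suc k ℕ.* (k ! ℕ.* S[n,k]))
      ≡⟨ sym (ℤₚ.pos-+ (suc k ℕ.* (suc k ! ℕ.* S[n,k+1])) _) ⟩
    + (suc k ℕ.* (suc k ! ℕ.* S[n,k+1]) ℕ.+ suc k ℕ.* (k ! ℕ.* S[n,k]))
      ≡⟨ cong +_ (regroup (suc k) (k !) S[n,k] S[n,k+1]) ⟩
    + (suc k ! ℕ.* stirling₂ (suc n) (suc k)) ∎)
    where
    open ≡-Reasoning
    xⁿ : ℕ → ℤ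
    xⁿ j = (+ j) ^ n
    S[n,k] = stirling₂ n k
    S[n,k+1] = stirling₂ n (suc k)
    regroup : ∀ K f a b → K ℕ.* ((K ℕ.* f) ℕ.* b) ℕ.+ K ℕ.* (f ℕ.* a) ≡ (K ℕ.* f) ℕ.* (a ℕ.+ K ℕ.* b)
    regroup = ℕ-Solver.solve-∀

  delay : ℕ → (ℕ → ℕ) → ℕ → ℕ
  delay zero    f b       = f b
  delay (suc q) f zero    = 0
  delay (suc q) f (suc b) = delay q f b

  delay-< : ∀ q f {b} → b < q → delay q f b ≡ 0
  delay-< (suc q) f {zero}  _         = refl
  delay-< (suc q) f {suc b} (s≤s b<q) = delay-< q f b<q

  delay-≥ : ∀ q f {b} → q ≤ b → delay q f b ≡ f (b ∸ q)
  delay-≥ zero    f _         = refl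
  delay-≥ (suc q) f (s≤s q≤b) = delay-≥ q f q≤b

  delay-sumTo : ∀ q M f → sumTo (q ℕ.+ M) (λ b → + delay q f b) ≡ sumTo M (λ b → + f b)
  delay-sumTo zero    M f = refl
  delay-sumTo (suc q) M f = trans (ℤₚ.+-identityˡ _) (delay-sumTo q M f)

  delay-stirling₂ : ∀ q n b → delay q (stirling₂ (suc n)) (suc b) ≡
                    delay q (stirling₂ n) b ℕ.+ (suc b ∸ q) ℕ.* delay q (stirling₂ n) (suc b)
  delay-stirling₂ zero          n b       = refl
  delay-stirling₂ (suc zero)    n zero    = refl
  delay-stirling₂ (suc (suc q)) n zero    = refl
  delay-stirling₂ (suc q)       n (suc b) = delay-stirling₂ q n b

  bell : ℕ → ℤ
  bell n = sumTo (suc n) (λ b → + stirling₂ n b)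

  bell-extend : ∀ {n M} → n < M → sumTo M (λ b → + stirling₂ n b) ≡ bell n
  bell-extend {n} {M} n<M =
    trans (cong (λ L → sumTo L (λ b → + stirling₂ n b)) (sym (ℕₚ.m+[n∸m]≡n n<M)))
          (sumTo-vanishing-tail (suc n) (M ∸ suc n) (λ b → + stirling₂ n b) (λ b n<b → cong +_ (stirling₂-vanishes n<b)))

  module _ {p : ℕ} (prime : Prime p) where

    open Modulo p

    private
      instance
        p-nonTrivial = prime⇒nonTrivial prime

      1<p : 1 < p
      1<p = ℕ.nonTrivial⇒n>1 p

    -- Fermat's little theorem inside k! S(p,k) = Δᵏxᵖ(0); k! is a unit modulo p since k < p.
    stirling₂[p,k]≈stirling₂[1,k] : ∀ {k} → k < p → + stirling₂ p k ≈ + stirling₂ 1 k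
    stirling₂[p,k]≈stirling₂[1,k] {k} k<p = *-cancelˡ-≈ prime (k !) (p∤k! prime k<p) (begin
      + (k !) * + stirling₂ p k       ≡⟨ ℤₚ.pos-* (k !) (stirling₂ p k) ⟨
      + (k ! ℕ.* stirling₂ p k)       ≡⟨ k!*stirling₂≡Δᵏxⁿ p k ⟩
      Δ k (λ j → (+ j) ^ p) 0
        ≈⟨ [E+]^-cong≈ -1ℤ k (λ j → ≈-trans (i^p≈i prime j) (≡⇒≈ (sym (ℤₚ.*-identityʳ (+ j))))) 0 ⟩
      Δ k (λ j → (+ j) ^ 1) 0         ≡⟨ k!*stirling₂≡Δᵏxⁿ 1 k ⟨
      + (k ! ℕ.* stirling₂ 1 k)       ≡⟨ ℤₚ.pos-* (k !) (stirling₂ 1 k) ⟩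
      + (k !) * + stirling₂ 1 k       ∎)
      where open ≈-Reasoning

    stirling₂-p : ∀ b → + stirling₂ p b ≈ + delay p (stirling₂ 0) b + + stirling₂ 1 b
    stirling₂-p b with ℕₚ.<-cmp b p
    ... | tri< b<p _ _ = ≈-trans (stirling₂[p,k]≈stirling₂[1,k] b<p)
                                 (≡⇒≈ (cong (λ z → + z + + stirling₂ 1 b) (sym (delay-< p (stirling₂ 0) b<p))))
    ... | tri≈ _ refl _ = ≡⇒≈ (cong +_ (trans (stirling₂-diag p) (sym (cong₂ ℕ._+_ delayed-diag (stirling₂-vanishes 1<p)))))
      where
      delayed-diag : delay p (stirling₂ 0) p ≡ 1
      delayed-diag = trans (delay-≥ p (stirling₂ 0) ℕₚ.≤-refl) (cong (stirling₂ 0) (ℕₚ.n∸n≡0 p))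
    ... | tri> _ _ p<b = ≡⇒≈ (cong +_ (trans (stirling₂-vanishes p<b) (sym (cong₂ ℕ._+_ delayed-zero (stirling₂-vanishes (ℕₚ.<-trans 1<p p<b))))))
      where
      delayed-zero : delay p (stirling₂ 0) b ≡ 0
      delayed-zero = trans (delay-≥ p (stirling₂ 0) (ℕₚ.<⇒≤ p<b)) (stirling₂-vanishes (ℕₚ.m<n⇒0<n∸m p<b))

    delay-coefficient : ∀ f c → + ((c ∸ p) ℕ.* delay p f c) ≈ + (c ℕ.* delay p f c)
    delay-coefficient f c with ℕₚ.<-≤-connex c p
    ... | inj₁ c<p = ≡⇒≈ (trans (vanishes (c ∸ p)) (sym (vanishes c)))
      where
      vanishes : ∀ d → + (d ℕ.* delay p f c) ≡ + 0
      vanishes d = cong +_ (trans (cong (d ℕ.*_) (delay-< p f c<p)) (ℕₚ.*-zeroʳ d))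
    ... | inj₂ p≤c = ≈-sym (begin
      + (c ℕ.* x)                          ≡⟨ cong (λ d → + (d ℕ.* x)) (sym (ℕₚ.m∸n+n≡m p≤c)) ⟩
      + ((c ∸ p ℕ.+ p) ℕ.* x)              ≡⟨ cong +_ (ℕₚ.*-distribʳ-+ x (c ∸ p) p) ⟩
      + ((c ∸ p) ℕ.* x ℕ.+ p ℕ.* x)        ≡⟨ ℤₚ.pos-+ ((c ∸ p) ℕ.* x) (p ℕ.* x) ⟩
      + ((c ∸ p) ℕ.* x) + + (p ℕ.* x)      ≡⟨ cong (_+_ (+ ((c ∸ p) ℕ.* x))) (ℤₚ.pos-* p x) ⟩
      + ((c ∸ p) ℕ.* x) + + p * + x        ≈⟨ +-cong (≈-refl {+ ((c ∸ p) ℕ.* x)}) (m*x≈0 (+ x)) ⟩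
      + ((c ∸ p) ℕ.* x) + + 0              ≡⟨ ℤₚ.+-identityʳ _ ⟩
      + ((c ∸ p) ℕ.* x)                    ∎)
      where
      open ≈-Reasoning
      x = delay p f c

    stirling₂-+p : ∀ n b → + stirling₂ (n ℕ.+ p) b ≈ + delay p (stirling₂ n) b + + stirling₂ (suc n) b
    stirling₂-+p zero    b       = stirling₂-p b
    stirling₂-+p (suc n) zero    = ≡⇒≈ (cong (λ z → + z + + 0) (sym (delay-< p (stirling₂ (suc n)) (ℕₚ.<-trans (s≤s z≤n) 1<p))))
    stirling₂-+p (suc n) (suc b) = begin
      + stirling₂ (suc n ℕ.+ p) (suc b)
        ≡⟨ ℤₚ.pos-+ (stirling₂ (n ℕ.+ p) b) _ ⟩
      + stirling₂ (n ℕ.+ p) b + + (suc b ℕ.* stirling₂ (n ℕ.+ p) (suc b))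
        ≡⟨ cong (_+_ (+ stirling₂ (n ℕ.+ p) b)) (ℤₚ.pos-* (suc b) _) ⟩
      + stirling₂ (n ℕ.+ p) b + + suc b * + stirling₂ (n ℕ.+ p) (suc b)
        ≈⟨ +-cong (stirling₂-+p n b) (*-congˡ (+ suc b) (stirling₂-+p n (suc b))) ⟩
      (+ D b + + S b) + + suc b * (+ D (suc b) + + S (suc b))
        ≡⟨ regroup (+ D b) (+ S b) (+ suc b) (+ D (suc b)) (+ S (suc b)) ⟩
      (+ D b + + suc b * + D (suc b)) + (+ S b + + suc b * + S (suc b))
        ≡⟨ cong₂ (λ x y → (+ D b + x) + (+ S b + y)) (sym (ℤₚ.pos-* (suc b) _)) (sym (ℤₚ.pos-* (suc b) _)) ⟩
      (+ D b + + (suc b ℕ.* D (suc b))) + + stirling₂ (suc (suc n)) (suc b)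
        ≈⟨ +-cong (+-cong (≈-refl {+ D b}) (delay-coefficient (stirling₂ n) (suc b))) (≈-refl {+ stirling₂ (suc (suc n)) (suc b)}) ⟨
      (+ D b + + ((suc b ∸ p) ℕ.* D (suc b))) + + stirling₂ (suc (suc n)) (suc b)
        ≡⟨ cong (λ z → + z + + stirling₂ (suc (suc n)) (suc b)) (sym (delay-stirling₂ p n b)) ⟩
      + delay p (stirling₂ (suc n)) (suc b) + + stirling₂ (suc (suc n)) (suc b) ∎
      where
      open ≈-Reasoning
      D = delay p (stirling₂ n)
      S = stirling₂ (suc n)
      regroup : ∀ a b c d e → (a + b) + c * (d + e) ≡ (a + c * d) + (b + c * e)
      regroup = solve-∀

    touchard : ∀ n → bell (n ℕ.+ p) ≈ bell n + bell (suc n)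
    touchard n = begin
      bell (n ℕ.+ p)
        ≡⟨ bell-extend n+p<M ⟨
      sumTo M (λ b → + stirling₂ (n ℕ.+ p) b)
        ≈⟨ sumTo-cong≈ M (stirling₂-+p n) ⟩
      sumTo M (λ b → + delay p (stirling₂ n) b + + stirling₂ (suc n) b)
        ≡⟨ sumTo-distrib-+ M (λ b → + delay p (stirling₂ n) b) (λ b → + stirling₂ (suc n) b) ⟩
      sumTo (p ℕ.+ suc (suc n)) (λ b → + delay p (stirling₂ n) b) + sumTo M (λ b → + stirling₂ (suc n) b)
        ≡⟨ cong₂ _+_ (delay-sumTo p (suc (suc n)) (stirling₂ n)) (bell-extend 1+n<M) ⟩
      sumTo (suc (suc n)) (λ b → + stirling₂ n b) + bell (suc n)
        ≡⟨ cong (_+ bell (suc n)) (bell-extend (ℕₚ.m<n⇒m<1+n (ℕₚ.n<1+n n))) ⟩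
      bell n + bell (suc n) ∎
      where
      open ≈-Reasoning
      M = p ℕ.+ suc (suc n)
      n+p<M : n ℕ.+ p < M
      n+p<M = subst (n ℕ.+ p <_) (shuffle n p) (ℕₚ.m<n⇒m<1+n (ℕₚ.n<1+n (n ℕ.+ p)))
        where
        shuffle : ∀ n p → suc (suc (n ℕ.+ p)) ≡ p ℕ.+ suc (suc n)
        shuffle = ℕ-Solver.solve-∀
      1+n<M : suc n < M
      1+n<M = ℕₚ.m≤n+m (suc (suc n)) p

    -- Such an array is aₖ(N) = (ΔᴺB)(k), so Touchard's congruence Eᵖ ≡ E + 1 on B carries over to every aₖ.
    module BellArray (a : ℕ → ℕ → ℕ)
                     (a-pascal : ∀ k N → a (suc k) N ≡ a k N ℕ.+ a k (suc N))
                     (a-bell : ∀ k → + a k 0 ≡ bell k) where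

      private
        aℤ : ℕ → ℕ → ℤ
        aℤ k N = + a k N

      a-step : ∀ k N → aℤ k (suc N) ≡ aℤ (suc k) N + -1ℤ * aℤ k N
      a-step k N = begin
        aℤ k (suc N)                           ≡⟨ cancel (aℤ k N) (aℤ k (suc N)) ⟩
        (aℤ k N + aℤ k (suc N)) + -1ℤ * aℤ k N
          ≡⟨ cong (λ z → z + -1ℤ * aℤ k N) (sym (trans (cong +_ (a-pascal k N)) (ℤₚ.pos-+ (a k N) _))) ⟩
        aℤ (suc k) N + -1ℤ * aℤ k N            ∎
        where
        open ≡-Reasoning
        cancel : ∀ x y → y ≡ (x + y) + -1ℤ * x
        cancel = solve-∀

      a≡Δbell : ∀ N k → aℤ k N ≡ Δ N bell k
      a≡Δbell zero    k = a-bell k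
      a≡Δbell (suc N) k = trans (a-step k N) (cong₂ (λ x y → x + -1ℤ * y) (a≡Δbell N (suc k)) (a≡Δbell N k))

      a-+p : ∀ N k → aℤ k (N ℕ.+ p) ≈ aℤ k N + aℤ k (suc N)
      a-+p zero k = begin
        aℤ k p                              ≡⟨ a≡Δbell p k ⟩
        Δ p bell k                          ≈⟨ [E+c]^p≈E^p+c^p prime -1ℤ bell k ⟩
        bell (k ℕ.+ p) + -1ℤ ^ p * bell k   ≈⟨ +-cong (touchard k) (*-congʳ (bell k) (-1^p≈-1 prime)) ⟩
        (bell k + bell (suc k)) + -1ℤ * bell k ≡⟨ ℤₚ.+-assoc (bell k) (bell (suc k)) _ ⟩
        bell k + (bell (suc k) + -1ℤ * bell k) ≡⟨ cong₂ _+_ (sym (a-bell k)) (sym (a≡Δbell 1 k)) ⟩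
        aℤ k 0 + aℤ k 1                     ∎
        where open ≈-Reasoning
      a-+p (suc N) k = begin
        aℤ k (suc (N ℕ.+ p))
          ≡⟨ a-step k (N ℕ.+ p) ⟩
        aℤ (suc k) (N ℕ.+ p) + -1ℤ * aℤ k (N ℕ.+ p)
          ≈⟨ +-cong (a-+p N (suc k)) (*-congˡ -1ℤ (a-+p N k)) ⟩
        (aℤ (suc k) N + aℤ (suc k) (suc N)) + -1ℤ * (aℤ k N + aℤ k (suc N))
          ≡⟨ regroup (aℤ (suc k) N) (aℤ (suc k) (suc N)) (aℤ k N) (aℤ k (suc N)) ⟩
        (aℤ (suc k) N + -1ℤ * aℤ k N) + (aℤ (suc k) (suc N) + -1ℤ * aℤ k (suc N))
          ≡⟨ cong₂ _+_ (sym (a-step k N)) (sym (a-step k (suc N))) ⟩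
        aℤ k (suc N) + aℤ k (suc (suc N)) ∎
        where
        open ≈-Reasoning
        regroup : ∀ a b c d → (a + b) + -1ℤ * (c + d) ≡ (a + -1ℤ * c) + (b + -1ℤ * d)
        regroup = solve-∀

      -- Induction on m: a step of length pᵐ acts like E + m, so a step of length pᵐ⁺¹ acts like
      -- (E + m)ᵖ ≡ Eᵖ + mᵖ ≡ (E + 1) + m.
      a-+pᵐ : ∀ m N k → aℤ k (N ℕ.+ p ℕ.^ m) ≈ + m * aℤ k N + aℤ k (suc N)
      a-+pᵐ zero N k = ≡⇒≈ (trans (cong (aℤ k) (ℕₚ.+-comm N 1)) (sym (ℤₚ.+-identityˡ (aℤ k (suc N)))))
      a-+pᵐ (suc m) N k = begin
        aℤ k (N ℕ.+ p ℕ.* pᵐ)                  ≈⟨ steps p N ⟩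
        ([E+ + m ]^ p) (aℤ k) N                ≈⟨ [E+c]^p≈E^p+c^p prime (+ m) (aℤ k) N ⟩
        aℤ k (N ℕ.+ p) + (+ m) ^ p * aℤ k N    ≈⟨ +-cong (a-+p N k) (*-congʳ (aℤ k N) (i^p≈i prime m)) ⟩
        (aℤ k N + aℤ k (suc N)) + + m * aℤ k N ≡⟨ regroup (aℤ k N) (aℤ k (suc N)) (+ m) ⟩
        + suc m * aℤ k N + aℤ k (suc N)        ∎
        where
        open ≈-Reasoning
        pᵐ = p ℕ.^ m
        regroup : ∀ x y c → (x + y) + c * x ≡ (+ 1 + c) * x + y
        regroup = solve-∀
        steps : ∀ i N → aℤ k (N ℕ.+ i ℕ.* pᵐ) ≈ ([E+ + m ]^ i) (aℤ k) N
        steps zero    N = ≡⇒≈ (cong (aℤ k) (trans (cong (N ℕ.+_) (ℕₚ.*-zeroˡ pᵐ)) (ℕₚ.+-identityʳ N)))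
        steps (suc i) N = begin
          aℤ k (N ℕ.+ (pᵐ ℕ.+ i ℕ.* pᵐ))                     ≡⟨ cong (aℤ k) (shuffle N pᵐ (i ℕ.* pᵐ)) ⟩
          aℤ k ((N ℕ.+ i ℕ.* pᵐ) ℕ.+ pᵐ)                     ≈⟨ a-+pᵐ m (N ℕ.+ i ℕ.* pᵐ) k ⟩
          + m * aℤ k (N ℕ.+ i ℕ.* pᵐ) + aℤ k (suc N ℕ.+ i ℕ.* pᵐ)
                                                            ≈⟨ +-cong (*-congˡ (+ m) (steps i N)) (steps i (suc N)) ⟩
          + m * ([E+ + m ]^ i) (aℤ k) N + ([E+ + m ]^ i) (aℤ k) (suc N)
                                                            ≡⟨ ℤₚ.+-comm (+ m * ([E+ + m ]^ i) (aℤ k) N) _ ⟩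
          ([E+ + m ]^ suc i) (aℤ k) N                        ∎
          where
          shuffle : ∀ N q r → N ℕ.+ (q ℕ.+ r) ≡ (N ℕ.+ r) ℕ.+ q
          shuffle = ℕ-Solver.solve-∀

module PrescribedSingletons where

  open import Defs
  open import Function using (_∘_)
  open import Data.Nat using (ℕ; zero; suc; _+_; _*_; _≤_; _<_; s≤s)
  import Data.Nat.Properties as ℕₚ
  import Data.Nat.Tactic.RingSolver as ℕ-Solver
  open import Data.Bool using (Bool; true; false) renaming (_≟_ to _≟ᵇ_)
  open import Data.Bool.Properties using (¬-not)
  open import Data.Fin as Fin using (Fin; zero; suc; toℕ)
  open import Data.Fin.Properties as Finₚ using (all?)
  open import Data.Vec as Vec using (Vec; []; _∷_; lookup; tabulate)
  import Data.Vec.Properties as Vecₚ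
  open import Data.List as List using (List; []; _∷_; _++_; concatMap; filter; length)
  open import Data.Product using (_×_; _,_; proj₂)
  open import Data.Unit using (⊤; tt)
  open import Data.Empty using (⊥-elim)
  open import Relation.Nullary using (Dec; yes; no; ¬_; _×-dec_; ¬?)
  open import Relation.Binary.PropositionalEquality
  open import Relation.Binary.Definitions using (tri<; tri≈; tri>)

  𝟙 : ∀ {a} {P : Set a} → Dec P → ℕ
  𝟙 (yes _) = 1
  𝟙 (no _)  = 0

  𝟙-cong : ∀ {a b} {P : Set a} {Q : Set b} → (P → Q) → (Q → P) → (P? : Dec P) (Q? : Dec Q) → 𝟙 P? ≡ 𝟙 Q?
  𝟙-cong P⇒Q Q⇒P (yes p) (yes q) = refl
  𝟙-cong P⇒Q Q⇒P (yes p) (no ¬q) = ⊥-elim (¬q (P⇒Q p))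
  𝟙-cong P⇒Q Q⇒P (no ¬p) (yes q) = ⊥-elim (¬p (Q⇒P q))
  𝟙-cong P⇒Q Q⇒P (no ¬p) (no ¬q) = refl

  𝟙-× : ∀ {a b} {P : Set a} {Q : Set b} (P? : Dec P) (Q? : Dec Q) → 𝟙 (P? ×-dec Q?) ≡ 𝟙 P? * 𝟙 Q?
  𝟙-× (yes _) (yes _) = refl
  𝟙-× (yes _) (no _)  = refl
  𝟙-× (no _)  (yes _) = refl
  𝟙-× (no _)  (no _)  = refl

  𝟙-yes : ∀ {a} {P : Set a} (P? : Dec P) → P → 𝟙 P? ≡ 1
  𝟙-yes (yes _) _ = refl
  𝟙-yes (no ¬p) p = ⊥-elim (¬p p)

  𝟙-no : ∀ {a} {P : Set a} (P? : Dec P) → ¬ P → 𝟙 P? ≡ 0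
  𝟙-no (yes p) ¬p = ⊥-elim (¬p p)
  𝟙-no (no _)  _  = refl

  ∑ : ∀ {a} {A : Set a} → List A → (A → ℕ) → ℕ
  ∑ []       f = 0
  ∑ (x ∷ xs) f = f x + ∑ xs f

  module _ {a} {A : Set a} where

    ∑-cong : ∀ (xs : List A) {f g : A → ℕ} → (∀ x → f x ≡ g x) → ∑ xs f ≡ ∑ xs g
    ∑-cong []       f≡g = refl
    ∑-cong (x ∷ xs) f≡g = cong₂ _+_ (f≡g x) (∑-cong xs f≡g)

    ∑-++ : ∀ (xs ys : List A) f → ∑ (xs ++ ys) f ≡ ∑ xs f + ∑ ys f
    ∑-++ []       ys f = refl
    ∑-++ (x ∷ xs) ys f = trans (cong (f x +_) (∑-++ xs ys f)) (sym (ℕₚ.+-assoc (f x) _ _))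

    ∑-distrib-+ : ∀ (xs : List A) f g → ∑ xs (λ x → f x + g x) ≡ ∑ xs f + ∑ xs g
    ∑-distrib-+ []       f g = refl
    ∑-distrib-+ (x ∷ xs) f g =
      trans (cong (f x + g x +_) (∑-distrib-+ xs f g)) (interchange (f x) (g x) (∑ xs f) (∑ xs g))
      where
      interchange : ∀ a b c d → a + b + (c + d) ≡ a + c + (b + d)
      interchange = ℕ-Solver.solve-∀

    ∑-distribˡ-* : ∀ (xs : List A) c f → ∑ xs (λ x → c * f x) ≡ c * ∑ xs f
    ∑-distribˡ-* []       c f = sym (ℕₚ.*-zeroʳ c)
    ∑-distribˡ-* (x ∷ xs) c f = trans (cong (c * f x +_) (∑-distribˡ-* xs c f)) (sym (ℕₚ.*-distribˡ-+ c (f x) _))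

    ∑-zero : ∀ (xs : List A) f → (∀ x → f x ≡ 0) → ∑ xs f ≡ 0
    ∑-zero []       f f≡0 = refl
    ∑-zero (x ∷ xs) f f≡0 = cong₂ _+_ (f≡0 x) (∑-zero xs f f≡0)

    length-filter≡∑𝟙 : ∀ {p} {P : A → Set p} (P? : ∀ x → Dec (P x)) xs → length (filter P? xs) ≡ ∑ xs (𝟙 ∘ P?)
    length-filter≡∑𝟙 P? []       = refl
    length-filter≡∑𝟙 P? (x ∷ xs) with P? x
    ... | yes _ = cong suc (length-filter≡∑𝟙 P? xs)
    ... | no _  = length-filter≡∑𝟙 P? xs

  module _ {a b} {A : Set a} {B : Set b} where

    ∑-concatMap : ∀ (g : A → List B) (xs : List A) f → ∑ (concatMap g xs) f ≡ ∑ xs (λ x → ∑ (g x) f)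
    ∑-concatMap g []       f = refl
    ∑-concatMap g (x ∷ xs) f = trans (∑-++ (g x) _ f) (cong (∑ (g x) f +_) (∑-concatMap g xs f))

    ∑-map : ∀ (g : A → B) (xs : List A) f → ∑ (List.map g xs) f ≡ ∑ xs (f ∘ g)
    ∑-map g []       f = refl
    ∑-map g (x ∷ xs) f = cong (f (g x) +_) (∑-map g xs f)

    ∑-comm : ∀ (xs : List A) (ys : List B) (h : A → B → ℕ) →
             ∑ xs (λ x → ∑ ys (h x)) ≡ ∑ ys (λ y → ∑ xs (λ x → h x y))
    ∑-comm []       ys h = sym (∑-zero ys (λ _ → 0) (λ _ → refl))
    ∑-comm (x ∷ xs) ys h = trans (cong (∑ ys (h x) +_) (∑-comm xs ys h))
                                 (sym (∑-distrib-+ ys (h x) (λ y → ∑ xs (λ x′ → h x′ y))))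

  allVecs : ∀ {a} {A : Set a} (n : ℕ) → List A → List (Vec A n)
  allVecs zero    xs = [] ∷ []
  allVecs (suc n) xs = concatMap (λ x → List.map (x ∷_) (allVecs n xs)) xs

  module _ {a} {A : Set a} where

    ∑-allVecs-suc : ∀ n (xs : List A) (W : Vec A (suc n) → ℕ) →
                    ∑ (allVecs (suc n) xs) W ≡ ∑ xs (λ x → ∑ (allVecs n xs) (λ v → W (x ∷ v)))
    ∑-allVecs-suc n xs W = trans (∑-concatMap _ xs W) (∑-cong xs (λ x → ∑-map (x ∷_) (allVecs n xs) W))

    ∑-allVecs-cong : ∀ (xs ys : List A) → (∀ h → ∑ xs h ≡ ∑ ys h) →
                     ∀ n (W : Vec A n → ℕ) → ∑ (allVecs n xs) W ≡ ∑ (allVecs n ys) W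
    ∑-allVecs-cong xs ys ∑xs≡∑ys zero    W = refl
    ∑-allVecs-cong xs ys ∑xs≡∑ys (suc n) W = begin
      ∑ (allVecs (suc n) xs) W                            ≡⟨ ∑-allVecs-suc n xs W ⟩
      ∑ xs (λ x → ∑ (allVecs n xs) (λ v → W (x ∷ v)))
        ≡⟨ ∑-cong xs (λ x → ∑-allVecs-cong xs ys ∑xs≡∑ys n (λ v → W (x ∷ v))) ⟩
      ∑ xs (λ x → ∑ (allVecs n ys) (λ v → W (x ∷ v)))     ≡⟨ ∑xs≡∑ys _ ⟩
      ∑ ys (λ x → ∑ (allVecs n ys) (λ v → W (x ∷ v)))     ≡⟨ ∑-allVecs-suc n ys W ⟨
      ∑ (allVecs (suc n) ys) W                            ∎
      where open ≡-Reasoning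

    ∑-allVecs-map : ∀ (ψ : A → A) (xs : List A) → (∀ h → ∑ xs (h ∘ ψ) ≡ ∑ xs h) →
                    ∀ n (W : Vec A n → ℕ) → ∑ (allVecs n xs) (W ∘ Vec.map ψ) ≡ ∑ (allVecs n xs) W
    ∑-allVecs-map ψ xs ∑∘ψ≡∑ zero    W = refl
    ∑-allVecs-map ψ xs ∑∘ψ≡∑ (suc n) W = begin
      ∑ (allVecs (suc n) xs) (W ∘ Vec.map ψ)              ≡⟨ ∑-allVecs-suc n xs _ ⟩
      ∑ xs (λ x → ∑ (allVecs n xs) (λ v → W (ψ x ∷ Vec.map ψ v)))
                                                          ≡⟨ ∑-cong xs (λ x → ∑-allVecs-map ψ xs ∑∘ψ≡∑ n (λ v → W (ψ x ∷ v))) ⟩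
      ∑ xs (λ x → ∑ (allVecs n xs) (λ v → W (ψ x ∷ v)))   ≡⟨ ∑∘ψ≡∑ (λ y → ∑ (allVecs n xs) (λ v → W (y ∷ v))) ⟩
      ∑ xs (λ y → ∑ (allVecs n xs) (λ v → W (y ∷ v)))     ≡⟨ ∑-allVecs-suc n xs W ⟨
      ∑ (allVecs (suc n) xs) W                            ∎
      where open ≡-Reasoning

  ∑-allVecs-unzip : ∀ {a} {A : Set a} n m (xs : List A) (W : Vec (Vec A (suc m)) n → ℕ) →
                    ∑ (allVecs n (allVecs (suc m) xs)) W ≡
                    ∑ (allVecs n xs) (λ c → ∑ (allVecs n (allVecs m xs)) (λ G → W (Vec.zipWith _∷_ c G)))
  ∑-allVecs-unzip zero    m xs W = sym (ℕₚ.+-identityʳ (W [] + 0))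
  ∑-allVecs-unzip (suc n) m xs W = begin
    ∑ (allVecs (suc n) (allVecs (suc m) xs)) W
      ≡⟨ ∑-allVecs-suc n (allVecs (suc m) xs) W ⟩
    ∑ (allVecs (suc m) xs) (λ row → ∑ (allVecs n (allVecs (suc m) xs)) (λ G → W (row ∷ G)))
      ≡⟨ ∑-allVecs-suc m xs _ ⟩
    ∑ xs (λ x → ∑ (allVecs m xs) (λ r → ∑ (allVecs n (allVecs (suc m) xs)) (λ G → W ((x ∷ r) ∷ G))))
      ≡⟨ ∑-cong xs (λ x → ∑-cong (allVecs m xs) (λ r → ∑-allVecs-unzip n m xs (λ G → W ((x ∷ r) ∷ G)))) ⟩
    ∑ xs (λ x → ∑ (allVecs m xs) (λ r → ∑ (allVecs n xs) (λ c → ∑ (allVecs n (allVecs m xs))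
         (λ G → W ((x ∷ r) ∷ Vec.zipWith _∷_ c G)))))
      ≡⟨ ∑-cong xs (λ x → ∑-comm (allVecs m xs) (allVecs n xs) _) ⟩
    ∑ xs (λ x → ∑ (allVecs n xs) (λ c → ∑ (allVecs m xs) (λ r → ∑ (allVecs n (allVecs m xs))
         (λ G → W ((x ∷ r) ∷ Vec.zipWith _∷_ c G)))))
      ≡⟨ ∑-cong xs (λ x → ∑-cong (allVecs n xs) (λ c → ∑-allVecs-suc n (allVecs m xs) _)) ⟨
    ∑ xs (λ x → ∑ (allVecs n xs) (λ c → ∑ (allVecs (suc n) (allVecs m xs))
         (λ G → W (Vec.zipWith _∷_ (x ∷ c) G))))
      ≡⟨ ∑-allVecs-suc n xs _ ⟨
    ∑ (allVecs (suc n) xs) (λ c → ∑ (allVecs (suc n) (allVecs m xs)) (λ G → W (Vec.zipWith _∷_ c G)))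
      ∎
    where open ≡-Reasoning

  ∑-allFuns-tabulate : ∀ {a b} {A : Set a} {B : Set b} (g : A → B) n (xs : List A) (W : Vec B n → ℕ) →
                       ∑ (allFuns n xs) (λ f → W (tabulate (g ∘ f))) ≡ ∑ (allVecs n (List.map g xs)) W
  ∑-allFuns-tabulate g zero    xs W = refl
  ∑-allFuns-tabulate g (suc n) xs W = begin
    ∑ (allFuns (suc n) xs) (λ f → W (tabulate (g ∘ f)))
      ≡⟨ ∑-concatMap _ xs _ ⟩
    ∑ xs (λ x → ∑ (List.map _ (allFuns n xs)) (λ f → W (tabulate (g ∘ f))))
      ≡⟨ ∑-cong xs (λ x → trans (∑-map _ (allFuns n xs) _) (∑-allFuns-tabulate g n xs (λ v → W (g x ∷ v)))) ⟩
    ∑ xs (λ x → ∑ (allVecs n (List.map g xs)) (λ v → W (g x ∷ v)))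
      ≡⟨ ∑-map g xs (λ y → ∑ (allVecs n (List.map g xs)) (λ v → W (y ∷ v))) ⟨
    ∑ (List.map g xs) (λ y → ∑ (allVecs n (List.map g xs)) (λ v → W (y ∷ v)))
      ≡⟨ ∑-allVecs-suc n (List.map g xs) W ⟨
    ∑ (allVecs (suc n) (List.map g xs)) W
      ∎
    where open ≡-Reasoning

  bools : List Bool
  bools = true ∷ false ∷ []

  allRows : (n : ℕ) → List (Vec Bool n)
  allRows n = allVecs n bools

  BoolMatrix : ℕ → Set
  BoolMatrix n = Vec (Vec Bool n) n

  allMatrices : (n : ℕ) → List (BoolMatrix n)
  allMatrices n = allVecs n (allRows n)

  BoolRel : ℕ → Set
  BoolRel n = Fin n → Fin n → Bool

  toRel : ∀ {n} → BoolMatrix n → BoolRel n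
  toRel V i j = lookup (lookup V i) j

  fromRel : ∀ {n} → BoolRel n → BoolMatrix n
  fromRel R = tabulate (λ i → tabulate (R i))

  toRel-fromRel : ∀ {n} (R : BoolRel n) i j → toRel (fromRel R) i j ≡ R i j
  toRel-fromRel R i j = trans (cong (λ v → lookup v j) (Vecₚ.lookup∘tabulate _ i)) (Vecₚ.lookup∘tabulate _ j)

  -- Counting over matrices rather than over the functions enumerated in Defs lets relations be split
  -- into first row, first column and remaining block, and permuted, as vectors.
  ∑-allRelations≡∑-allMatrices : ∀ n (W : BoolMatrix n → ℕ) → ∑ (allRelations n) (W ∘ fromRel) ≡ ∑ (allMatrices n) W
  ∑-allRelations≡∑-allMatrices n W =
    trans (∑-allFuns-tabulate (λ f → tabulate f) n (allFuns n bools) W)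
          (∑-allVecs-cong _ _ (λ h → trans (∑-map _ (allFuns n bools) h) (∑-allFuns-tabulate (λ b → b) n bools h)) n W)

  _≗₂_ : ∀ {n} → BoolRel n → BoolRel n → Set
  R ≗₂ R′ = ∀ i j → R i j ≡ R′ i j

  ≗₂-sym : ∀ {n} {R R′ : BoolRel n} → R ≗₂ R′ → R′ ≗₂ R
  ≗₂-sym R≗R′ i j = sym (R≗R′ i j)

  IsPartition-resp : ∀ {n} {R R′ : BoolRel n} → R ≗₂ R′ → IsPartition R → IsPartition R′
  IsPartition-resp R≗R′ (refl′ , sym′ , trans′) =
    (λ i → trans (sym (R≗R′ i i)) (refl′ i)) ,
    (λ i j Rij → trans (sym (R≗R′ j i)) (sym′ i j (trans (R≗R′ i j) Rij))) ,
    (λ i j l Rij Rjl → trans (sym (R≗R′ i l)) (trans′ i j l (trans (R≗R′ i j) Rij) (trans (R≗R′ j l) Rjl)))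

  IsSingleton-resp : ∀ {n} {R R′ : BoolRel n} → R ≗₂ R′ → ∀ i → IsSingleton R i → IsSingleton R′ i
  IsSingleton-resp R≗R′ i s j R′ij = s j (trans (R≗R′ i j) R′ij)

  data Constraint : Set where
    free single shared : Constraint

  Satisfies : ∀ {n} → Constraint → BoolRel n → Fin n → Set
  Satisfies free   R i = ⊤
  Satisfies single R i = IsSingleton R i
  Satisfies shared R i = ¬ IsSingleton R i

  satisfies? : ∀ {n} c (R : BoolRel n) i → Dec (Satisfies c R i)
  satisfies? free   R i = yes tt
  satisfies? single R i = isSingleton? R i
  satisfies? shared R i = ¬? (isSingleton? R i)

  Satisfies-resp : ∀ {n} {R R′ : BoolRel n} → R ≗₂ R′ → ∀ c i → Satisfies c R i → Satisfies c R′ i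
  Satisfies-resp R≗R′ free   i _         = tt
  Satisfies-resp R≗R′ single i s         = IsSingleton-resp R≗R′ i s
  Satisfies-resp R≗R′ shared i ¬s s′     = ¬s (IsSingleton-resp (≗₂-sym R≗R′) i s′)

  Admissible : ∀ {n} → (Fin n → Constraint) → BoolRel n → Set
  Admissible ℓ R = IsPartition R × (∀ i → Satisfies (ℓ i) R i)

  admissible? : ∀ {n} (ℓ : Fin n → Constraint) (R : BoolRel n) → Dec (Admissible ℓ R)
  admissible? ℓ R = isPartition? R ×-dec all? (λ i → satisfies? (ℓ i) R i)

  Admissible-resp : ∀ {n} {R R′ : BoolRel n} {ℓ ℓ′ : Fin n → Constraint} →
                    R ≗₂ R′ → (∀ i → ℓ i ≡ ℓ′ i) → Admissible ℓ R → Admissible ℓ′ R′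
  Admissible-resp R≗R′ ℓ≡ℓ′ (part , sat) =
    IsPartition-resp R≗R′ part , (λ i → subst (λ c → Satisfies c _ i) (ℓ≡ℓ′ i) (Satisfies-resp R≗R′ _ i (sat i)))

  #admissible : ∀ n → (Fin n → Constraint) → ℕ
  #admissible n ℓ = ∑ (allMatrices n) (λ V → 𝟙 (admissible? ℓ (toRel V)))

  #admissible-cong : ∀ n {ℓ ℓ′ : Fin n → Constraint} → (∀ i → ℓ i ≡ ℓ′ i) →
                     #admissible n ℓ ≡ #admissible n ℓ′
  #admissible-cong n ℓ≡ℓ′ = ∑-cong (allMatrices n) (λ V →
    𝟙-cong (Admissible-resp (λ _ _ → refl) ℓ≡ℓ′) (Admissible-resp (λ _ _ → refl) (λ i → sym (ℓ≡ℓ′ i))) _ _)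

  largestSingleton : ℕ → ℕ → Constraint
  largestSingleton zero    zero    = single
  largestSingleton zero    (suc x) = shared
  largestSingleton (suc k) zero    = free
  largestSingleton (suc k) (suc x) = largestSingleton k x

  largestSingleton-< : ∀ {k x} → x < k → largestSingleton k x ≡ free
  largestSingleton-< {suc k} {zero}  _         = refl
  largestSingleton-< {suc k} {suc x} (s≤s x<k) = largestSingleton-< x<k

  largestSingleton-≡ : ∀ k → largestSingleton k k ≡ single
  largestSingleton-≡ zero    = refl
  largestSingleton-≡ (suc k) = largestSingleton-≡ k

  largestSingleton-> : ∀ {k x} → k < x → largestSingleton k x ≡ shared
  largestSingleton-> {zero}  {suc x} _         = refl
  largestSingleton-> {suc k} {suc x} (s≤s k<x) = largestSingleton-> k<x

  LargestSingletonIs⇒Admissible : ∀ {n} (R : BoolRel n) k → IsPartition R × LargestSingletonIs R k →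
                                  Admissible (largestSingleton k ∘ toℕ) R
  LargestSingletonIs⇒Admissible R k (part , ((i₀ , i₀≡k , single-i₀) , larger-shared)) = part , sat
    where
    sat : ∀ i → Satisfies (largestSingleton k (toℕ i)) R i
    sat i with ℕₚ.<-cmp (toℕ i) k
    ... | tri< i<k _ _ rewrite largestSingleton-< i<k = tt
    ... | tri≈ _ i≡k _ rewrite i≡k | largestSingleton-≡ k =
      subst (IsSingleton R) (Finₚ.toℕ-injective (trans i₀≡k (sym i≡k))) single-i₀
    ... | tri> _ _ k<i rewrite largestSingleton-> k<i = larger-shared i k<i

  Admissible⇒LargestSingletonIs : ∀ {n} (R : BoolRel n) k → k < n → Admissible (largestSingleton k ∘ toℕ) R →
                                  IsPartition R × LargestSingletonIs R k
  Admissible⇒LargestSingletonIs R k k<n (part , sat) =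
    part , ((Fin.fromℕ< k<n , Finₚ.toℕ-fromℕ< k<n , single-k) , larger-shared)
    where
    single-k : IsSingleton R (Fin.fromℕ< k<n)
    single-k = subst (λ c → Satisfies c R (Fin.fromℕ< k<n))
                     (trans (cong (largestSingleton k) (Finₚ.toℕ-fromℕ< k<n)) (largestSingleton-≡ k))
                     (sat (Fin.fromℕ< k<n))
    larger-shared : ∀ j → k < toℕ j → ¬ IsSingleton R j
    larger-shared j k<j = subst (λ c → Satisfies c R j) (largestSingleton-> k<j) (sat j)

  A≡#admissible : ∀ {n k} → k ≤ n → A n k ≡ #admissible (suc n) (largestSingleton k ∘ toℕ)
  A≡#admissible {n} {k} k≤n = begin
    A n k
      ≡⟨ length-filter≡∑𝟙 (λ R → isPartition? R ×-dec largestSingletonIs? R k) (allRelations (suc n)) ⟩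
    ∑ (allRelations (suc n)) (λ R → 𝟙 (isPartition? R ×-dec largestSingletonIs? R k))
      ≡⟨ ∑-cong (allRelations (suc n)) same-indicator ⟩
    ∑ (allRelations (suc n)) (λ R → 𝟙 (admissible? ℓ (toRel (fromRel R))))
      ≡⟨ ∑-allRelations≡∑-allMatrices (suc n) (λ V → 𝟙 (admissible? ℓ (toRel V))) ⟩
    #admissible (suc n) ℓ
      ∎
    where
    open ≡-Reasoning
    ℓ = largestSingleton k ∘ toℕ
    same-indicator : ∀ R → 𝟙 (isPartition? R ×-dec largestSingletonIs? R k) ≡ 𝟙 (admissible? ℓ (toRel (fromRel R)))
    same-indicator R = 𝟙-cong
      (Admissible-resp (≗₂-sym (toRel-fromRel R)) (λ _ → refl) ∘ LargestSingletonIs⇒Admissible R k)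
      (Admissible⇒LargestSingletonIs R k (s≤s k≤n) ∘ Admissible-resp (toRel-fromRel R) (λ _ → refl)) _ _

  _∷ᶜ_ : ∀ {n} → Constraint → (Fin n → Constraint) → Fin (suc n) → Constraint
  (c ∷ᶜ ℓ) zero    = c
  (c ∷ᶜ ℓ) (suc i) = ℓ i

  Admissible-head : ∀ {M} {ℓ : Fin M → Constraint} {c c′} {R : BoolRel (suc M)} →
                    (Satisfies c R zero → Satisfies c′ R zero) → Admissible (c ∷ᶜ ℓ) R → Admissible (c′ ∷ᶜ ℓ) R
  Admissible-head c⇒c′ (part , sat) = part , λ { zero → c⇒c′ (sat zero) ; (suc i) → sat (suc i) }

  𝟙-free : ∀ {M} (ℓ : Fin M → Constraint) (R : BoolRel (suc M)) →
           𝟙 (admissible? (free ∷ᶜ ℓ) R) ≡ 𝟙 (admissible? (single ∷ᶜ ℓ) R) + 𝟙 (admissible? (shared ∷ᶜ ℓ) R)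
  𝟙-free ℓ R = split (isSingleton? R zero)
    where
    open ≡-Reasoning
    free? = admissible? (free ∷ᶜ ℓ) R
    single? = admissible? (single ∷ᶜ ℓ) R
    shared? = admissible? (shared ∷ᶜ ℓ) R
    split : Dec (IsSingleton R zero) → 𝟙 free? ≡ 𝟙 single? + 𝟙 shared?
    split (yes s) = begin
      𝟙 free?                ≡⟨ 𝟙-cong (Admissible-head (λ _ → s)) (Admissible-head _) free? single? ⟩
      𝟙 single?              ≡⟨ ℕₚ.+-identityʳ _ ⟨
      𝟙 single? + 0          ≡⟨ cong (𝟙 single? +_) (𝟙-no shared? (λ (_ , sat) → sat zero s)) ⟨
      𝟙 single? + 𝟙 shared?  ∎
    split (no ¬s) = begin
      𝟙 free?                ≡⟨ 𝟙-cong (Admissible-head (λ _ → ¬s)) (Admissible-head _) free? shared? ⟩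
      𝟙 shared?              ≡⟨ cong (_+ 𝟙 shared?) (𝟙-no single? (λ (_ , sat) → ¬s (sat zero))) ⟨
      𝟙 single? + 𝟙 shared?  ∎

  #admissible-free : ∀ M (ℓ : Fin M → Constraint) →
                     #admissible (suc M) (free ∷ᶜ ℓ) ≡
                     #admissible (suc M) (single ∷ᶜ ℓ) + #admissible (suc M) (shared ∷ᶜ ℓ)
  #admissible-free M ℓ =
    trans (∑-cong (allMatrices (suc M)) (λ V → 𝟙-free ℓ (toRel V))) (∑-distrib-+ (allMatrices (suc M)) _ _)

  border : ∀ {M} → Bool → (Fin M → Bool) → (Fin M → Bool) → BoolRel M → BoolRel (suc M)
  border b r c R zero    zero    = b
  border b r c R zero    (suc j) = r j
  border b r c R (suc i) zero    = c i
  border b r c R (suc i) (suc j) = R i j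

  border-cong : ∀ {M} {b b′ : Bool} {r r′ c c′ : Fin M → Bool} {R R′ : BoolRel M} →
                b ≡ b′ → (∀ j → r j ≡ r′ j) → (∀ j → c j ≡ c′ j) → R ≗₂ R′ →
                border b r c R ≗₂ border b′ r′ c′ R′
  border-cong b≡b′ r≡r′ c≡c′ R≗R′ zero    zero    = b≡b′
  border-cong b≡b′ r≡r′ c≡c′ R≗R′ zero    (suc j) = r≡r′ j
  border-cong b≡b′ r≡r′ c≡c′ R≗R′ (suc i) zero    = c≡c′ i
  border-cong b≡b′ r≡r′ c≡c′ R≗R′ (suc i) (suc j) = R≗R′ i j

  toRel-border : ∀ {M} b (r c : Vec Bool M) (G : BoolMatrix M) →
                 toRel ((b ∷ r) ∷ Vec.zipWith _∷_ c G) ≗₂ border b (lookup r) (lookup c) (toRel G)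
  toRel-border b r c G zero    zero    = refl
  toRel-border b r c G zero    (suc j) = refl
  toRel-border b r c G (suc i) zero    = cong (λ v → lookup v zero) (Vecₚ.lookup-zipWith _∷_ i c G)
  toRel-border b r c G (suc i) (suc j) = cong (λ v → lookup v (suc j)) (Vecₚ.lookup-zipWith _∷_ i c G)

  ∑-allMatrices-border : ∀ M (f : BoolRel (suc M) → ℕ) → (∀ {R R′} → R ≗₂ R′ → f R ≡ f R′) →
    ∑ (allMatrices (suc M)) (f ∘ toRel) ≡
    ∑ bools (λ b → ∑ (allRows M) (λ r → ∑ (allRows M) (λ c → ∑ (allMatrices M) (λ G →
      f (border b (lookup r) (lookup c) (toRel G))))))
  ∑-allMatrices-border M f f-resp =
    trans (∑-allVecs-suc M (allRows (suc M)) _)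
    (trans (∑-allVecs-suc M bools _)
    (∑-cong bools (λ b → ∑-cong (allRows M) (λ r →
      trans (∑-allVecs-unzip M M bools (λ G → f (toRel ((b ∷ r) ∷ G))))
            (∑-cong (allRows M) (λ c → ∑-cong (allMatrices M) (λ G → f-resp (toRel-border b r c G))))))))

  𝟙-resp : ∀ {n} {P : BoolRel n → Set} (P? : ∀ R → Dec (P R)) → (∀ {R R′} → R ≗₂ R′ → P R → P R′) →
           ∀ {R R′} → R ≗₂ R′ → 𝟙 (P? R) ≡ 𝟙 (P? R′)
  𝟙-resp P? P-resp R≗R′ = 𝟙-cong (P-resp R≗R′) (P-resp (≗₂-sym R≗R′)) _ _

  ∑-bools-𝟙≡ : ∀ y X → ∑ bools (λ x → 𝟙 (x ≟ᵇ y) * X) ≡ X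
  ∑-bools-𝟙≡ true  X = trans (ℕₚ.+-identityʳ (X + 0)) (ℕₚ.+-identityʳ X)
  ∑-bools-𝟙≡ false X = trans (ℕₚ.+-identityʳ (X + 0)) (ℕₚ.+-identityʳ X)

  _≟ᵛ_ : ∀ {n} → (u v : Vec Bool n) → Dec (u ≡ v)
  _≟ᵛ_ = Vecₚ.≡-dec _≟ᵇ_

  ∑-allRows-𝟙≡ : ∀ M (v₀ : Vec Bool M) X → ∑ (allRows M) (λ v → 𝟙 (v ≟ᵛ v₀) * X) ≡ X
  ∑-allRows-𝟙≡ zero    []       X = trans (ℕₚ.+-identityʳ (X + 0)) (ℕₚ.+-identityʳ X)
  ∑-allRows-𝟙≡ (suc M) (y ∷ v₀) X = begin
    ∑ (allRows (suc M)) (λ v → 𝟙 (v ≟ᵛ (y ∷ v₀)) * X)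
      ≡⟨ ∑-allVecs-suc M bools _ ⟩
    ∑ bools (λ x → ∑ (allRows M) (λ v → 𝟙 ((x ∷ v) ≟ᵛ (y ∷ v₀)) * X))
      ≡⟨ ∑-cong bools (λ x → ∑-cong (allRows M) (λ v → split x v)) ⟩
    ∑ bools (λ x → ∑ (allRows M) (λ v → 𝟙 (x ≟ᵇ y) * (𝟙 (v ≟ᵛ v₀) * X)))
      ≡⟨ ∑-cong bools (λ x → ∑-distribˡ-* (allRows M) (𝟙 (x ≟ᵇ y)) (λ v → 𝟙 (v ≟ᵛ v₀) * X)) ⟩
    ∑ bools (λ x → 𝟙 (x ≟ᵇ y) * ∑ (allRows M) (λ v → 𝟙 (v ≟ᵛ v₀) * X))
      ≡⟨ ∑-cong bools (λ x → cong (𝟙 (x ≟ᵇ y) *_) (∑-allRows-𝟙≡ M v₀ X)) ⟩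
    ∑ bools (λ x → 𝟙 (x ≟ᵇ y) * X)
      ≡⟨ ∑-bools-𝟙≡ y X ⟩
    X ∎
    where
    open ≡-Reasoning
    split : ∀ x v → 𝟙 ((x ∷ v) ≟ᵛ (y ∷ v₀)) * X ≡ 𝟙 (x ≟ᵇ y) * (𝟙 (v ≟ᵛ v₀) * X)
    split x v = begin
      𝟙 ((x ∷ v) ≟ᵛ (y ∷ v₀)) * X
        ≡⟨ cong (_* X) (𝟙-cong Vecₚ.∷-injective (λ (x≡y , v≡v₀) → cong₂ _∷_ x≡y v≡v₀) ((x ∷ v) ≟ᵛ (y ∷ v₀)) ((x ≟ᵇ y) ×-dec (v ≟ᵛ v₀))) ⟩
      𝟙 ((x ≟ᵇ y) ×-dec (v ≟ᵛ v₀)) * X       ≡⟨ cong (_* X) (𝟙-× (x ≟ᵇ y) (v ≟ᵛ v₀)) ⟩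
      𝟙 (x ≟ᵇ y) * 𝟙 (v ≟ᵛ v₀) * X           ≡⟨ ℕₚ.*-assoc (𝟙 (x ≟ᵇ y)) _ X ⟩
      𝟙 (x ≟ᵇ y) * (𝟙 (v ≟ᵛ v₀) * X)         ∎

  zeros : ∀ n → Vec Bool n
  zeros n = Vec.replicate n false

  lookup≡false⇒≡zeros : ∀ {n} (r : Vec Bool n) → (∀ j → lookup r j ≡ false) → r ≡ zeros n
  lookup≡false⇒≡zeros []      _        = refl
  lookup≡false⇒≡zeros (x ∷ r) r≡false = cong₂ _∷_ (r≡false zero) (lookup≡false⇒≡zeros r (r≡false ∘ suc))

  lookup-zeros : ∀ {n} (j : Fin n) → lookup (zeros n) j ≡ false
  lookup-zeros j = Vecₚ.lookup-replicate j false

  true≢false : true ≢ false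
  true≢false ()

  module _ {M : ℕ} {b : Bool} {r c : Fin M → Bool} {R : BoolRel M} where

    private
      B = border b r c R

    border-corner : IsPartition B → b ≡ true
    border-corner (refl′ , _) = refl′ zero

    border-inner : IsPartition B → IsPartition R
    border-inner (refl′ , sym′ , trans′) =
      refl′ ∘ suc , (λ i j → sym′ (suc i) (suc j)) , (λ i j l → trans′ (suc i) (suc j) (suc l))

    border-row≡column : IsPartition B → ∀ j → r j ≡ c j
    border-row≡column (_ , sym′ , _) j with r j in r≡ | c j in c≡
    ... | true  | true  = refl
    ... | false | false = refl
    ... | true  | false = ⊥-elim (true≢false (trans (sym (sym′ zero (suc j) r≡)) c≡))
    ... | false | true  = ⊥-elim (true≢false (trans (sym (sym′ (suc j) zero c≡)) r≡))

    singleton₀⇒row≡false : IsSingleton B zero → ∀ j → r j ≡ false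
    singleton₀⇒row≡false s j = ¬-not (λ r≡true → Finₚ.0≢1+n (sym (s (suc j) r≡true)))

    row≡false⇒singleton₀ : (∀ j → r j ≡ false) → IsSingleton B zero
    row≡false⇒singleton₀ r≡false zero    _        = refl
    row≡false⇒singleton₀ r≡false (suc j) r≡true = ⊥-elim (true≢false (trans (sym r≡true) (r≡false j)))

    singletonₛ⇒inner : ∀ {i} → IsSingleton B (suc i) → IsSingleton R i
    singletonₛ⇒inner s j Rij = Finₚ.suc-injective (s (suc j) Rij)

    inner⇒singletonₛ : ∀ {i} → c i ≡ false → IsSingleton R i → IsSingleton B (suc i)
    inner⇒singletonₛ c≡false s zero    c≡true = ⊥-elim (true≢false (trans (sym c≡true) c≡false))
    inner⇒singletonₛ c≡false s (suc j) Rij    = cong suc (s j Rij)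

  addIsolated : ∀ {M} → BoolRel M → BoolRel (suc M)
  addIsolated = border true (λ _ → false) (λ _ → false)

  IsPartition-addIsolated : ∀ {M} {R : BoolRel M} → IsPartition R → IsPartition (addIsolated R)
  IsPartition-addIsolated {R = R} (refl′ , sym′ , trans′) = refl″ , sym″ , trans″
    where
    refl″ : ∀ i → addIsolated R i i ≡ true
    refl″ zero    = refl
    refl″ (suc i) = refl′ i
    sym″ : ∀ i j → addIsolated R i j ≡ true → addIsolated R j i ≡ true
    sym″ zero    zero    R₀₀ = R₀₀
    sym″ (suc i) (suc j) Rij = sym′ i j Rij
    trans″ : ∀ i j l → addIsolated R i j ≡ true → addIsolated R j l ≡ true → addIsolated R i l ≡ true
    trans″ zero    zero    l       _   R₀l = R₀l
    trans″ (suc i) (suc j) (suc l) Rij Rjl = trans′ i j l Rij Rjl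

  IsIsolatedBorder : ∀ {M} → Bool → (Fin M → Bool) → (Fin M → Bool) → Set
  IsIsolatedBorder b r c = b ≡ true × (∀ j → r j ≡ false) × (∀ j → c j ≡ false)

  singleton₀⇒isolatedBorder : ∀ {M b r c} {R : BoolRel M} → IsPartition (border b r c R) → IsSingleton (border b r c R) zero →
                              IsIsolatedBorder b r c
  singleton₀⇒isolatedBorder part s =
    border-corner part , singleton₀⇒row≡false s , λ j → trans (sym (border-row≡column part j)) (singleton₀⇒row≡false s j)

  Admissible-single⇒ : ∀ {M} (ℓ : Fin M → Constraint) {b r c R} →
                       Admissible (single ∷ᶜ ℓ) (border b r c R) → IsIsolatedBorder b r c × Admissible ℓ R
  Admissible-single⇒ ℓ {R = R} (part , sat) = isolated , border-inner part , sat′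
    where
    isolated = singleton₀⇒isolatedBorder part (sat zero)
    sat′ : ∀ i → Satisfies (ℓ i) R i
    sat′ i with ℓ i | sat (suc i)
    ... | free   | _  = tt
    ... | single | s  = singletonₛ⇒inner s
    ... | shared | ¬s = λ s → ¬s (inner⇒singletonₛ (proj₂ (proj₂ isolated) i) s)

  Admissible-single⇐ : ∀ {M} (ℓ : Fin M → Constraint) {R} → Admissible ℓ R → Admissible (single ∷ᶜ ℓ) (addIsolated R)
  Admissible-single⇐ ℓ {R} (part , sat) = IsPartition-addIsolated part , sat′
    where
    sat′ : ∀ i → Satisfies ((single ∷ᶜ ℓ) i) (addIsolated R) i
    sat′ zero = row≡false⇒singleton₀ (λ _ → refl)
    sat′ (suc i) with ℓ i | sat i
    ... | free   | _  = tt
    ... | single | s  = inner⇒singletonₛ refl s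
    ... | shared | ¬s = λ s → ¬s (singletonₛ⇒inner s)

  -- Only relations of the form addIsolated R pass the test, so the sums over the corner, the first row
  -- and the first column collapse.
  ∑-addIsolated : ∀ M {P : BoolRel (suc M) → Set} (P? : ∀ R → Dec (P R)) →
                  (∀ {R R′} → R ≗₂ R′ → P R → P R′) →
                  {Q : BoolRel M → Set} (Q? : ∀ R → Dec (Q R)) →
                  (∀ {b r c R} → P (border b r c R) → IsIsolatedBorder b r c × Q R) →
                  (∀ {R} → Q R → P (addIsolated R)) →
                  ∑ (allMatrices (suc M)) (𝟙 ∘ P? ∘ toRel) ≡ ∑ (allMatrices M) (𝟙 ∘ Q? ∘ toRel)
  ∑-addIsolated M {P} P? P-resp {Q} Q? P⇒Q Q⇒P = begin
    ∑ (allMatrices (suc M)) (𝟙 ∘ P? ∘ toRel)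
      ≡⟨ ∑-allMatrices-border M (𝟙 ∘ P?) (𝟙-resp P? P-resp) ⟩
    ∑ bools (λ b → ∑ (allRows M) (λ r → ∑ (allRows M) (λ c → ∑ (allMatrices M) (λ G →
      𝟙 (P? (border b (lookup r) (lookup c) (toRel G)))))))
      ≡⟨ ∑-cong bools (λ b → ∑-cong (allRows M) (λ r → ∑-cong (allRows M) (λ c → ∑-over-inner b r c))) ⟩
    ∑ bools (λ b → ∑ (allRows M) (λ r → ∑ (allRows M) (λ c → 𝟙 (c ≟ᵛ zeros M) * (𝟙 (r ≟ᵛ zeros M) * (𝟙 (b ≟ᵇ true) * #Q)))))
      ≡⟨ ∑-cong bools (λ b → ∑-cong (allRows M) (λ r → ∑-allRows-𝟙≡ M (zeros M) (𝟙 (r ≟ᵛ zeros M) * (𝟙 (b ≟ᵇ true) * #Q)))) ⟩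
    ∑ bools (λ b → ∑ (allRows M) (λ r → 𝟙 (r ≟ᵛ zeros M) * (𝟙 (b ≟ᵇ true) * #Q)))
      ≡⟨ ∑-cong bools (λ b → ∑-allRows-𝟙≡ M (zeros M) (𝟙 (b ≟ᵇ true) * #Q)) ⟩
    ∑ bools (λ b → 𝟙 (b ≟ᵇ true) * #Q)
      ≡⟨ ∑-bools-𝟙≡ true #Q ⟩
    #Q ∎
    where
    open ≡-Reasoning
    #Q = ∑ (allMatrices M) (𝟙 ∘ Q? ∘ toRel)
    pointwise : ∀ b r c G → 𝟙 (P? (border b (lookup r) (lookup c) (toRel G))) ≡
                𝟙 (c ≟ᵛ zeros M) * (𝟙 (r ≟ᵛ zeros M) * (𝟙 (b ≟ᵇ true) * 𝟙 (Q? (toRel G))))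
    pointwise b r c G = begin
      𝟙 (P? (border b (lookup r) (lookup c) (toRel G)))
        ≡⟨ 𝟙-cong ⇒ ⇐ _ ((c ≟ᵛ zeros M) ×-dec ((r ≟ᵛ zeros M) ×-dec ((b ≟ᵇ true) ×-dec Q? (toRel G)))) ⟩
      𝟙 ((c ≟ᵛ zeros M) ×-dec ((r ≟ᵛ zeros M) ×-dec ((b ≟ᵇ true) ×-dec Q? (toRel G))))
        ≡⟨ trans (𝟙-× (c ≟ᵛ zeros M) _) (cong (𝟙 (c ≟ᵛ zeros M) *_) (trans (𝟙-× (r ≟ᵛ zeros M) _)
             (cong (𝟙 (r ≟ᵛ zeros M) *_) (𝟙-× (b ≟ᵇ true) (Q? (toRel G)))))) ⟩
      𝟙 (c ≟ᵛ zeros M) * (𝟙 (r ≟ᵛ zeros M) * (𝟙 (b ≟ᵇ true) * 𝟙 (Q? (toRel G)))) ∎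
      where
      ⇒ : P (border b (lookup r) (lookup c) (toRel G)) → c ≡ zeros M × r ≡ zeros M × b ≡ true × Q (toRel G)
      ⇒ p with P⇒Q p
      ... | (b≡true , r≡false , c≡false) , q = lookup≡false⇒≡zeros c c≡false , lookup≡false⇒≡zeros r r≡false , b≡true , q
      ⇐ : c ≡ zeros M × r ≡ zeros M × b ≡ true × Q (toRel G) → P (border b (lookup r) (lookup c) (toRel G))
      ⇐ (refl , refl , refl , q) = P-resp (border-cong refl (sym ∘ lookup-zeros) (sym ∘ lookup-zeros) (λ _ _ → refl)) (Q⇒P q)
    ∑-over-inner : ∀ b r c → ∑ (allMatrices M) (λ G → 𝟙 (P? (border b (lookup r) (lookup c) (toRel G)))) ≡
                   𝟙 (c ≟ᵛ zeros M) * (𝟙 (r ≟ᵛ zeros M) * (𝟙 (b ≟ᵇ true) * #Q))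
    ∑-over-inner b r c =
      trans (∑-cong (allMatrices M) (pointwise b r c))
      (trans (∑-distribˡ-* (allMatrices M) (𝟙 (c ≟ᵛ zeros M)) _) (cong (𝟙 (c ≟ᵛ zeros M) *_)
      (trans (∑-distribˡ-* (allMatrices M) (𝟙 (r ≟ᵛ zeros M)) _) (cong (𝟙 (r ≟ᵛ zeros M) *_)
             (∑-distribˡ-* (allMatrices M) (𝟙 (b ≟ᵇ true)) _)))))

  #admissible-single : ∀ M (ℓ : Fin M → Constraint) → #admissible (suc M) (single ∷ᶜ ℓ) ≡ #admissible M ℓ
  #admissible-single M ℓ =
    ∑-addIsolated M (admissible? (single ∷ᶜ ℓ)) (λ R≗R′ → Admissible-resp R≗R′ (λ _ → refl)) (admissible? ℓ)
                  (Admissible-single⇒ ℓ) (Admissible-single⇐ ℓ)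

  -- swap j exchanges the positions j and j + 1 (and is the identity if j + 1 is out of range).
  swapVec : ∀ {a} {A : Set a} {n} → ℕ → Vec A n → Vec A n
  swapVec zero    []          = []
  swapVec zero    (x ∷ [])    = x ∷ []
  swapVec zero    (x ∷ y ∷ v) = y ∷ x ∷ v
  swapVec (suc j) []          = []
  swapVec (suc j) (x ∷ v)     = x ∷ swapVec j v

  swap : ℕ → ∀ {n} → Fin n → Fin n
  swap zero    {suc zero}    zero          = zero
  swap zero    {suc (suc n)} zero          = suc zero
  swap zero    {suc (suc n)} (suc zero)    = zero
  swap zero    {suc (suc n)} (suc (suc i)) = suc (suc i)
  swap (suc j) zero    = zero
  swap (suc j) (suc i) = suc (swap j i)

  lookup-swapVec : ∀ {a} {A : Set a} {n} j (v : Vec A n) i → lookup (swapVec j v) i ≡ lookup v (swap j i)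
  lookup-swapVec zero    (x ∷ [])    zero          = refl
  lookup-swapVec zero    (x ∷ y ∷ v) zero          = refl
  lookup-swapVec zero    (x ∷ y ∷ v) (suc zero)    = refl
  lookup-swapVec zero    (x ∷ y ∷ v) (suc (suc i)) = refl
  lookup-swapVec (suc j) (x ∷ v)     zero          = refl
  lookup-swapVec (suc j) (x ∷ v)     (suc i)       = lookup-swapVec j v i

  swap-involutive : ∀ j {n} (i : Fin n) → swap j (swap j i) ≡ i
  swap-involutive zero    {suc zero}    zero          = refl
  swap-involutive zero    {suc (suc n)} zero          = refl
  swap-involutive zero    {suc (suc n)} (suc zero)    = refl
  swap-involutive zero    {suc (suc n)} (suc (suc i)) = refl
  swap-involutive (suc j) zero    = refl
  swap-involutive (suc j) (suc i) = cong suc (swap-involutive j i)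

  swapVec-map : ∀ {a b} {A : Set a} {B : Set b} {n} j (f : A → B) (v : Vec A n) →
                swapVec j (Vec.map f v) ≡ Vec.map f (swapVec j v)
  swapVec-map zero    f []          = refl
  swapVec-map zero    f (x ∷ [])    = refl
  swapVec-map zero    f (x ∷ y ∷ v) = refl
  swapVec-map (suc j) f []          = refl
  swapVec-map (suc j) f (x ∷ v)     = cong (f x ∷_) (swapVec-map j f v)

  ∑-allVecs-swap : ∀ {a} {A : Set a} j n (xs : List A) (W : Vec A n → ℕ) →
                   ∑ (allVecs n xs) (W ∘ swapVec j) ≡ ∑ (allVecs n xs) W
  ∑-allVecs-swap zero    zero          xs W = refl
  ∑-allVecs-swap zero    (suc zero)    xs W = ∑-cong (allVecs 1 xs) (λ { (x ∷ []) → refl })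
  ∑-allVecs-swap zero    (suc (suc m)) xs W =
    trans (∑-allVecs-suc (suc m) xs _)
    (trans (∑-cong xs (λ x → ∑-allVecs-suc m xs _))
    (trans (∑-comm xs xs _)
    (trans (∑-cong xs (λ y → sym (∑-allVecs-suc m xs _))) (sym (∑-allVecs-suc (suc m) xs W)))))
  ∑-allVecs-swap (suc j) zero    xs W = refl
  ∑-allVecs-swap (suc j) (suc m) xs W =
    trans (∑-allVecs-suc m xs _)
    (trans (∑-cong xs (λ x → ∑-allVecs-swap j m xs (λ v → W (x ∷ v)))) (sym (∑-allVecs-suc m xs W)))

  swapMatrix : ∀ {n} → ℕ → BoolMatrix n → BoolMatrix n
  swapMatrix j V = swapVec j (Vec.map (swapVec j) V)

  ∑-allMatrices-swap : ∀ n j (W : BoolMatrix n → ℕ) → ∑ (allMatrices n) (W ∘ swapMatrix j) ≡ ∑ (allMatrices n) W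
  ∑-allMatrices-swap n j W =
    trans (∑-cong (allMatrices n) (λ V → cong W (swapVec-map j (swapVec j) V)))
    (trans (∑-allVecs-swap j n (allRows n) (W ∘ Vec.map (swapVec j)))
           (∑-allVecs-map (swapVec j) (allRows n) (∑-allVecs-swap j n bools) n W))

  toRel-swapMatrix : ∀ {n} j (V : BoolMatrix n) i i′ → toRel (swapMatrix j V) i i′ ≡ toRel V (swap j i) (swap j i′)
  toRel-swapMatrix j V i i′ =
    trans (cong (λ v → lookup v i′) (trans (lookup-swapVec j (Vec.map (swapVec j) V) i) (Vecₚ.lookup-map (swap j i) (swapVec j) V)))
          (lookup-swapVec j (lookup V (swap j i)) i′)

  Admissible-swap : ∀ {n} j (ℓ : Fin n → Constraint) (R : BoolRel n) → Admissible ℓ R →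
                    Admissible (ℓ ∘ swap j) (λ i i′ → R (swap j i) (swap j i′))
  Admissible-swap j ℓ R ((refl′ , sym′ , trans′) , sat) =
    (refl′ ∘ swap j , (λ i i′ → sym′ (swap j i) (swap j i′)) , (λ i i′ i″ → trans′ (swap j i) (swap j i′) (swap j i″))) ,
    (λ i → sat′ (ℓ (swap j i)) i (sat (swap j i)))
    where
    Rₛ : BoolRel _
    Rₛ i i′ = R (swap j i) (swap j i′)
    singleton⇒ : ∀ i → IsSingleton R (swap j i) → IsSingleton Rₛ i
    singleton⇒ i s i′ Rₛii′ = trans (sym (swap-involutive j i′)) (trans (cong (swap j) (s (swap j i′) Rₛii′)) (swap-involutive j i))
    singleton⇐ : ∀ i → IsSingleton Rₛ i → IsSingleton R (swap j i)
    singleton⇐ i s i′ Rii′ = trans (sym (swap-involutive j i′))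
      (cong (swap j) (s (swap j i′) (subst (λ z → R (swap j i) z ≡ true) (sym (swap-involutive j i′)) Rii′)))
    sat′ : ∀ c i → Satisfies c R (swap j i) → Satisfies c Rₛ i
    sat′ free   i _     = tt
    sat′ single i s     = singleton⇒ i s
    sat′ shared i ¬s s′ = ¬s (singleton⇐ i s′)

  #admissible-swap : ∀ n j (ℓ : Fin n → Constraint) → #admissible n (ℓ ∘ swap j) ≡ #admissible n ℓ
  #admissible-swap n j ℓ = trans (sym (∑-allMatrices-swap n j _)) (∑-cong (allMatrices n) same-indicator)
    where
    same-indicator : ∀ V → 𝟙 (admissible? (ℓ ∘ swap j) (toRel (swapMatrix j V))) ≡ 𝟙 (admissible? ℓ (toRel V))
    same-indicator V = 𝟙-cong ⇒ ⇐ _ _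
      where
      ⇒ : Admissible (ℓ ∘ swap j) (toRel (swapMatrix j V)) → Admissible ℓ (toRel V)
      ⇒ adm = Admissible-resp
        (λ i i′ → trans (toRel-swapMatrix j V (swap j i) (swap j i′)) (cong₂ (toRel V) (swap-involutive j i) (swap-involutive j i′)))
        (λ i → cong ℓ (swap-involutive j i))
        (Admissible-swap j _ _ adm)
      ⇐ : Admissible ℓ (toRel V) → Admissible (ℓ ∘ swap j) (toRel (swapMatrix j V))
      ⇐ adm = Admissible-resp (λ i i′ → sym (toRel-swapMatrix j V i i′)) (λ _ → refl) (Admissible-swap j ℓ (toRel V) adm)

  swapℕ : ℕ → ℕ → ℕ
  swapℕ zero    zero          = 1
  swapℕ zero    (suc zero)    = 0
  swapℕ zero    (suc (suc x)) = suc (suc x)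
  swapℕ (suc j) zero          = 0
  swapℕ (suc j) (suc x)       = suc (swapℕ j x)

  toℕ-swap : ∀ j {n} (i : Fin n) → suc (suc j) ≤ n → toℕ (swap j i) ≡ swapℕ j (toℕ i)
  toℕ-swap zero    {suc zero}    zero          (s≤s ())
  toℕ-swap zero    {suc (suc n)} zero          _         = refl
  toℕ-swap zero    {suc (suc n)} (suc zero)    _         = refl
  toℕ-swap zero    {suc (suc n)} (suc (suc i)) _         = refl
  toℕ-swap (suc j) {suc n}       zero          _         = refl
  toℕ-swap (suc j) {suc n}       (suc i)       (s≤s j<n) = cong suc (toℕ-swap j i j<n)

  -- insertAt c π j: the constraints π with a new element constrained by c inserted at position j.
  insertAt : Constraint → (ℕ → Constraint) → ℕ → ℕ → Constraint
  insertAt c π zero    zero    = c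
  insertAt c π zero    (suc x) = π x
  insertAt c π (suc j) zero    = π 0
  insertAt c π (suc j) (suc x) = insertAt c (π ∘ suc) j x

  insertAt-swap : ∀ c π j x → insertAt c π j (swapℕ j x) ≡ insertAt c π (suc j) x
  insertAt-swap c π zero    zero          = refl
  insertAt-swap c π zero    (suc zero)    = refl
  insertAt-swap c π zero    (suc (suc x)) = refl
  insertAt-swap c π (suc j) zero          = refl
  insertAt-swap c π (suc j) (suc x)       = insertAt-swap c (π ∘ suc) j x

  #admissible-insertAt : ∀ n c π j → j < n →
                         #admissible n (insertAt c π j ∘ toℕ) ≡ #admissible n (insertAt c π 0 ∘ toℕ)
  #admissible-insertAt n c π zero    _   = refl
  #admissible-insertAt n c π (suc j) j<n = begin
    #admissible n (insertAt c π (suc j) ∘ toℕ)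
      ≡⟨ #admissible-cong n (λ i → trans (sym (insertAt-swap c π j (toℕ i))) (cong (insertAt c π j) (sym (toℕ-swap j i j<n)))) ⟩
    #admissible n (insertAt c π j ∘ toℕ ∘ swap j)
      ≡⟨ #admissible-swap n j (insertAt c π j ∘ toℕ) ⟩
    #admissible n (insertAt c π j ∘ toℕ)
      ≡⟨ #admissible-insertAt n c π j (ℕₚ.<-trans (ℕₚ.n<1+n j) j<n) ⟩
    #admissible n (insertAt c π 0 ∘ toℕ) ∎
    where open ≡-Reasoning

  insertAt-shared-largestSingleton : ∀ k x → insertAt shared (largestSingleton k) (suc k) x ≡ largestSingleton k x
  insertAt-shared-largestSingleton zero    zero          = refl
  insertAt-shared-largestSingleton zero    (suc zero)    = refl
  insertAt-shared-largestSingleton zero    (suc (suc x)) = refl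
  insertAt-shared-largestSingleton (suc k) zero          = refl
  insertAt-shared-largestSingleton (suc k) (suc x)       = insertAt-shared-largestSingleton k x

  insertAt-single-free : ∀ {k x} → x ≤ k → insertAt single (λ _ → free) k x ≡ largestSingleton k x
  insertAt-single-free {zero}  {zero}  _         = refl
  insertAt-single-free {suc k} {zero}  _         = refl
  insertAt-single-free {suc k} {suc x} (s≤s x≤k) = insertAt-single-free x≤k

module PartitionsIntoBlocks where

  open import Defs
  open PrescribedSingletons
  open import Function using (_∘_; id)
  open import Data.Nat as ℕ using (ℕ; zero; suc; _+_; _*_; _≤_; _<_; z≤n; s≤s; _≟_)
  import Data.Nat.Properties as ℕₚ
  open import Data.Bool using (Bool; true; false) renaming (_≟_ to _≟ᵇ_)
  open import Data.Bool.Properties using (¬-not)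
  open import Data.Fin as Fin using (Fin; zero; suc; toℕ)
  open import Data.Fin.Properties as Finₚ using (all?)
  open import Data.Vec using (Vec; lookup; tabulate)
  import Data.Vec.Properties as Vecₚ
  open import Data.List as List using (List; allFin)
  import Data.List.Properties as Listₚ
  open import Data.Product using (Σ; _×_; _,_; proj₁; proj₂)
  open import Data.Empty using (⊥-elim)
  open import Relation.Nullary using (Dec; yes; no; ¬_; _×-dec_; ¬?; _→-dec_)
  open import Relation.Binary.PropositionalEquality
  open import Relation.Binary.Definitions using (tri<; tri≈; tri>)

  ∑Fin : ∀ n → (Fin n → ℕ) → ℕ
  ∑Fin n = ∑ (allFin n)

  ∑Fin-suc : ∀ n (f : Fin (suc n) → ℕ) → ∑Fin (suc n) f ≡ f zero + ∑Fin n (f ∘ suc)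
  ∑Fin-suc n f = cong (f zero +_) (trans (cong (λ xs → ∑ xs f) (sym (Listₚ.map-tabulate id suc))) (∑-map suc (allFin n) f))

  ∑Fin-𝟙-unique : ∀ n {P : Fin n → Set} (P? : ∀ t → Dec (P t)) t₀ → P t₀ → (∀ t → P t → t ≡ t₀) →
                  ∑Fin n (𝟙 ∘ P?) ≡ 1
  ∑Fin-𝟙-unique (suc n) P? zero Pt₀ unique = begin
    ∑Fin (suc n) (𝟙 ∘ P?)          ≡⟨ ∑Fin-suc n _ ⟩
    𝟙 (P? zero) + ∑Fin n (𝟙 ∘ P? ∘ suc)
      ≡⟨ cong₂ _+_ (𝟙-yes (P? zero) Pt₀) (∑-zero (allFin n) _ (λ t → 𝟙-no (P? (suc t)) (Finₚ.0≢1+n ∘ sym ∘ unique (suc t)))) ⟩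
    1                              ∎
    where open ≡-Reasoning
  ∑Fin-𝟙-unique (suc n) P? (suc t₀) Pt₀ unique = begin
    ∑Fin (suc n) (𝟙 ∘ P?)          ≡⟨ ∑Fin-suc n _ ⟩
    𝟙 (P? zero) + ∑Fin n (𝟙 ∘ P? ∘ suc)
      ≡⟨ cong₂ _+_ (𝟙-no (P? zero) (Finₚ.0≢1+n ∘ unique zero)) (∑Fin-𝟙-unique n (P? ∘ suc) t₀ Pt₀ (λ t → Finₚ.suc-injective ∘ unique (suc t))) ⟩
    1                              ∎
    where open ≡-Reasoning

  ∑Fin-𝟙≤n : ∀ n {P : Fin n → Set} (P? : ∀ t → Dec (P t)) → ∑Fin n (𝟙 ∘ P?) ≤ n
  ∑Fin-𝟙≤n zero    P? = z≤n
  ∑Fin-𝟙≤n (suc n) P? =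
    subst (_≤ suc n) (sym (∑Fin-suc n (𝟙 ∘ P?))) (ℕₚ.+-mono-≤ (𝟙≤1 (P? zero)) (∑Fin-𝟙≤n n (P? ∘ suc)))
    where
    𝟙≤1 : ∀ {a} {P : Set a} (P? : Dec P) → 𝟙 P? ≤ 1
    𝟙≤1 (yes _) = s≤s z≤n
    𝟙≤1 (no _)  = z≤n

  -- Blocks are counted through their least elements.
  IsLeast : ∀ {n} → BoolRel n → Fin n → Set
  IsLeast R t = ∀ j → toℕ j < toℕ t → R t j ≡ false

  isLeast? : ∀ {n} (R : BoolRel n) t → Dec (IsLeast R t)
  isLeast? R t = all? (λ j → (toℕ j ℕ.<? toℕ t) →-dec (R t j ≟ᵇ false))

  IsLeast-resp : ∀ {n} {R R′ : BoolRel n} → R ≗₂ R′ → ∀ {t} → IsLeast R t → IsLeast R′ t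
  IsLeast-resp R≗R′ {t} least j j<t = trans (sym (R≗R′ t j)) (least j j<t)

  IsLeast-unique : ∀ {n} {R : BoolRel n} → IsPartition R → ∀ {t t′} →
                   IsLeast R t → IsLeast R t′ → R t t′ ≡ true → t ≡ t′
  IsLeast-unique {R = R} (_ , sym′ , _) {t} {t′} least least′ Rtt′ with ℕₚ.<-cmp (toℕ t) (toℕ t′)
  ... | tri< t<t′ _ _ = ⊥-elim (true≢false (trans (sym (sym′ t t′ Rtt′)) (least′ t t<t′)))
  ... | tri≈ _ t≡t′ _ = Finₚ.toℕ-injective t≡t′
  ... | tri> _ _ t′<t = ⊥-elim (true≢false (trans (sym Rtt′) (least t′ t′<t)))

  #blocks : ∀ {n} → BoolRel n → ℕ
  #blocks {n} R = ∑Fin n (𝟙 ∘ isLeast? R)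

  #blocks-resp : ∀ {n} {R R′ : BoolRel n} → R ≗₂ R′ → #blocks R ≡ #blocks R′
  #blocks-resp {n} R≗R′ = ∑-cong (allFin n) (λ t → 𝟙-cong (IsLeast-resp R≗R′) (IsLeast-resp (≗₂-sym R≗R′)) _ _)

  #blocks-border : ∀ {M} b r c (R : BoolRel M) →
                   #blocks (border b r c R) ≡ suc (∑Fin M (λ t → 𝟙 ((c t ≟ᵇ false) ×-dec isLeast? R t)))
  #blocks-border {M} b r c R = trans (∑Fin-suc M _) (cong₂ _+_
    (𝟙-yes (isLeast? (border b r c R) zero) (λ _ ()))
    (∑-cong (allFin M) (λ t → 𝟙-cong
      (λ least → least zero (s≤s z≤n) , λ j j<t → least (suc j) (s≤s j<t))
      (λ (c≡false , least) → λ { zero _ → c≡false ; (suc j) (s≤s j<t) → least j j<t }) _ _)))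

  #blocks-border-isolated : ∀ {M} b r c (R : BoolRel M) → (∀ j → c j ≡ false) → #blocks (border b r c R) ≡ suc (#blocks R)
  #blocks-border-isolated {M} b r c R c≡false =
    trans (#blocks-border b r c R) (cong suc (∑-cong (allFin M) (λ t → 𝟙-cong proj₂ (c≡false t ,_) _ _)))

  IsPartitionInto : ∀ {n} → ℕ → BoolRel n → Set
  IsPartitionInto B R = IsPartition R × #blocks R ≡ B

  isPartitionInto? : ∀ {n} B (R : BoolRel n) → Dec (IsPartitionInto B R)
  isPartitionInto? B R = isPartition? R ×-dec (#blocks R ≟ B)

  IsPartitionInto-resp : ∀ {n} {B} {R R′ : BoolRel n} → R ≗₂ R′ → IsPartitionInto B R → IsPartitionInto B R′
  IsPartitionInto-resp R≗R′ (part , #R≡B) = IsPartition-resp R≗R′ part , trans (sym (#blocks-resp R≗R′)) #R≡B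

  #partitionsInto : ℕ → ℕ → ℕ
  #partitionsInto n B = ∑ (allMatrices n) (𝟙 ∘ isPartitionInto? B ∘ toRel)

  #partitions : ℕ → ℕ
  #partitions n = ∑ (allMatrices n) (𝟙 ∘ isPartition? ∘ toRel)

  #partitions≡∑#partitionsInto : ∀ n → #partitions n ≡ ∑ (List.upTo (suc n)) (#partitionsInto n)
  #partitions≡∑#partitionsInto n =
    trans (∑-cong (allMatrices n) (one-block-count ∘ toRel)) (∑-comm (allMatrices n) (List.upTo (suc n)) _)
    where
    ∑-upTo-𝟙≡ : ∀ N x → x < N → ∑ (List.upTo N) (λ B → 𝟙 (x ≟ B)) ≡ 1
    ∑-upTo-𝟙≡ (suc N) x x<N = begin
      𝟙 (x ≟ 0) + ∑ (List.applyUpTo suc N) (λ B → 𝟙 (x ≟ B))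
        ≡⟨ cong (λ xs → 𝟙 (x ≟ 0) + ∑ xs (λ B → 𝟙 (x ≟ B))) (sym (Listₚ.map-upTo suc N)) ⟩
      𝟙 (x ≟ 0) + ∑ (List.map suc (List.upTo N)) (λ B → 𝟙 (x ≟ B)) ≡⟨ cong (𝟙 (x ≟ 0) +_) (∑-map suc (List.upTo N) _) ⟩
      𝟙 (x ≟ 0) + ∑ (List.upTo N) (λ B → 𝟙 (x ≟ suc B))        ≡⟨ split x x<N ⟩
      1                                                      ∎
      where
      open ≡-Reasoning
      split : ∀ x → x < suc N → 𝟙 (x ≟ 0) + ∑ (List.upTo N) (λ B → 𝟙 (x ≟ suc B)) ≡ 1
      split zero    _         = cong suc (∑-zero (List.upTo N) _ (λ _ → refl))
      split (suc x) (s≤s x<N) = trans (∑-cong (List.upTo N) (λ B → 𝟙-cong ℕₚ.suc-injective (cong suc) _ _)) (∑-upTo-𝟙≡ N x x<N)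
    one-block-count : ∀ (R : BoolRel n) → 𝟙 (isPartition? R) ≡ ∑ (List.upTo (suc n)) (λ B → 𝟙 (isPartitionInto? B R))
    one-block-count R = sym (begin
      ∑ (List.upTo (suc n)) (λ B → 𝟙 (isPartitionInto? B R))
        ≡⟨ ∑-cong (List.upTo (suc n)) (λ B → 𝟙-× (isPartition? R) (#blocks R ≟ B)) ⟩
      ∑ (List.upTo (suc n)) (λ B → 𝟙 (isPartition? R) * 𝟙 (#blocks R ≟ B))
        ≡⟨ ∑-distribˡ-* (List.upTo (suc n)) (𝟙 (isPartition? R)) _ ⟩
      𝟙 (isPartition? R) * ∑ (List.upTo (suc n)) (λ B → 𝟙 (#blocks R ≟ B))
        ≡⟨ cong (𝟙 (isPartition? R) *_) (∑-upTo-𝟙≡ (suc n) (#blocks R) (s≤s (∑Fin-𝟙≤n n (isLeast? R)))) ⟩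
      𝟙 (isPartition? R) * 1                                          ≡⟨ ℕₚ.*-identityʳ _ ⟩
      𝟙 (isPartition? R)                                              ∎)
      where open ≡-Reasoning

  #partitionsInto-empty : ∀ B → #partitionsInto 0 B ≡ 𝟙 (0 ≟ B)
  #partitionsInto-empty B = trans (ℕₚ.+-identityʳ _) (𝟙-cong proj₂ (((λ ()) , (λ ()) , (λ ())) ,_) _ _)

  𝟙-split : ∀ {a b} {P : Set a} {Q : Set b} (P? : Dec P) (Q? : Dec Q) → 𝟙 P? ≡ 𝟙 (P? ×-dec Q?) + 𝟙 (P? ×-dec ¬? Q?)
  𝟙-split (yes _) (yes _) = refl
  𝟙-split (yes _) (no _)  = refl
  𝟙-split (no _)  (yes _) = refl
  𝟙-split (no _)  (no _)  = refl

  ∑-isolatedHead : ∀ M B →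
    ∑ (allMatrices (suc M)) (λ V → 𝟙 (isPartitionInto? B (toRel V) ×-dec isSingleton? (toRel V) zero)) ≡
    ∑ (allMatrices M) (λ G → 𝟙 (isPartition? (toRel G) ×-dec (suc (#blocks (toRel G)) ≟ B)))
  ∑-isolatedHead M B =
    ∑-addIsolated M (λ R → isPartitionInto? B R ×-dec isSingleton? R zero)
      (λ R≗R′ (into , s) → IsPartitionInto-resp R≗R′ into , IsSingleton-resp R≗R′ zero s)
      (λ R → isPartition? R ×-dec (suc (#blocks R) ≟ B)) ⇒ ⇐
    where
    ⇒ : ∀ {b r c R} → IsPartitionInto B (border b r c R) × IsSingleton (border b r c R) zero →
        IsIsolatedBorder b r c × (IsPartition R × suc (#blocks R) ≡ B)
    ⇒ {b} {r} {c} {R} ((part , #≡B) , s) = isolated , border-inner part ,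
      trans (sym (#blocks-border-isolated b r c R (proj₂ (proj₂ isolated)))) #≡B
      where isolated = singleton₀⇒isolatedBorder part s
    ⇐ : ∀ {R} → IsPartition R × suc (#blocks R) ≡ B → IsPartitionInto B (addIsolated R) × IsSingleton (addIsolated R) zero
    ⇐ {R} (part , 1+#≡B) =
      (IsPartition-addIsolated part , trans (#blocks-border-isolated true _ _ R (λ _ → refl)) 1+#≡B) ,
      row≡false⇒singleton₀ (λ _ → refl)

  ≡true-ext : ∀ {x y : Bool} → (x ≡ true → y ≡ true) → (y ≡ true → x ≡ true) → x ≡ y
  ≡true-ext {true}  {true}  _ _ = refl
  ≡true-ext {true}  {false} x⇒y _ = sym (x⇒y refl)
  ≡true-ext {false} {true}  _ y⇒x = y⇒x refl
  ≡true-ext {false} {false} _ _ = refl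

  -- Element 0 is not a singleton exactly when its row r is the indicator row of the block of some
  -- (unique) least element t of the remaining partition, so that 0 joins the block of t.
  module JoinedHead {M : ℕ} where

    joined⇒ : ∀ {b r c} {R : BoolRel M} → IsPartition (border b r c R) → ¬ IsSingleton (border b r c R) zero →
              b ≡ true × (∀ j → r j ≡ c j) × IsPartition R × Σ (Fin M) (λ t → IsLeast R t × (∀ j → r j ≡ R t j))
    joined⇒ {b} {r} {c} {R} part ¬s =
      border-corner part , border-row≡column part , border-inner part , t₀ , least , r≡Rt₀
      where
      trans′ = proj₂ (proj₂ part)
      smallest = Finₚ.¬∀⟶∃¬-smallest M (λ j → r j ≡ false) (λ j → r j ≟ᵇ false) (¬s ∘ row≡false⇒singleton₀)
      t₀ = proj₁ smallest
      rt₀ : r t₀ ≡ true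
      rt₀ = ¬-not (proj₁ (proj₂ smallest))
      ct₀ : c t₀ ≡ true
      ct₀ = trans (sym (border-row≡column part t₀)) rt₀
      r≡Rt₀ : ∀ j → r j ≡ R t₀ j
      r≡Rt₀ j = ≡true-ext (trans′ (suc t₀) zero (suc j) ct₀) (trans′ zero (suc t₀) (suc j) rt₀)
      least : IsLeast R t₀
      least j j<t₀ = trans (sym (r≡Rt₀ j)) (subst (λ i → r i ≡ false) j′≡j (proj₂ (proj₂ smallest) (Fin.fromℕ< j<t₀)))
        where
        j′≡j : Fin.inject (Fin.fromℕ< j<t₀) ≡ j
        j′≡j = Finₚ.toℕ-injective (trans (Finₚ.toℕ-inject (Fin.fromℕ< j<t₀)) (Finₚ.toℕ-fromℕ< j<t₀))

    joined⇐ : ∀ {r} {R : BoolRel M} {t₀} → IsPartition R → (∀ j → r j ≡ R t₀ j) →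
              IsPartition (border true r r R) × ¬ IsSingleton (border true r r R) zero
    joined⇐ {r} {R} {t₀} (refl′ , sym′ , trans′) r≡Rt₀ = (refl″ , sym″ , trans″) , ¬s
      where
      R⇒r : ∀ j → R t₀ j ≡ true → r j ≡ true
      R⇒r j Rt₀j = trans (r≡Rt₀ j) Rt₀j
      r⇒R : ∀ j → r j ≡ true → R t₀ j ≡ true
      r⇒R j rj = trans (sym (r≡Rt₀ j)) rj
      B′ = border true r r R
      refl″ : ∀ i → B′ i i ≡ true
      refl″ zero    = refl
      refl″ (suc i) = refl′ i
      sym″ : ∀ i j → B′ i j ≡ true → B′ j i ≡ true
      sym″ zero    zero    Bij = Bij
      sym″ zero    (suc j) Bij = Bij
      sym″ (suc i) zero    Bij = Bij
      sym″ (suc i) (suc j) Bij = sym′ i j Bij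
      trans″ : ∀ i j l → B′ i j ≡ true → B′ j l ≡ true → B′ i l ≡ true
      trans″ zero    zero    l       _   Bjl = Bjl
      trans″ zero    (suc j) zero    _   _   = refl
      trans″ zero    (suc j) (suc l) rj  Rjl = R⇒r l (trans′ t₀ j l (r⇒R j rj) Rjl)
      trans″ (suc i) zero    zero    ri  _   = ri
      trans″ (suc i) zero    (suc l) ri  rl  = trans′ i t₀ l (sym′ t₀ i (r⇒R i ri)) (r⇒R l rl)
      trans″ (suc i) (suc j) zero    Rij rj  = R⇒r i (trans′ t₀ j i (r⇒R j rj) (sym′ i j Rij))
      trans″ (suc i) (suc j) (suc l) Rij Rjl = trans′ i j l Rij Rjl
      ¬s : ¬ IsSingleton B′ zero
      ¬s s = Finₚ.0≢1+n (sym (s (suc t₀) (R⇒r t₀ (refl′ t₀))))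

    #blocks-joined : ∀ {r} {R : BoolRel M} {t₀} → IsPartition R → IsLeast R t₀ → (∀ j → r j ≡ R t₀ j) →
                     #blocks (border true r r R) ≡ #blocks R
    #blocks-joined {r} {R} {t₀} part least r≡Rt₀ = begin
      #blocks (border true r r R)
        ≡⟨ #blocks-border true r r R ⟩
      suc (∑Fin M (λ t → 𝟙 ((r t ≟ᵇ false) ×-dec isLeast? R t)))
        ≡⟨ cong (_+ _) (∑Fin-𝟙-unique M (Finₚ._≟ t₀) t₀ refl (λ _ t≡t₀ → t≡t₀)) ⟨
      ∑Fin M (λ t → 𝟙 (t Finₚ.≟ t₀)) + ∑Fin M (λ t → 𝟙 ((r t ≟ᵇ false) ×-dec isLeast? R t))
        ≡⟨ ∑-distrib-+ (allFin M) _ _ ⟨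
      ∑Fin M (λ t → 𝟙 (t Finₚ.≟ t₀) + 𝟙 ((r t ≟ᵇ false) ×-dec isLeast? R t))
        ≡⟨ ∑-cong (allFin M) (λ t → pointwise t (t Finₚ.≟ t₀) ((r t ≟ᵇ false) ×-dec isLeast? R t) (isLeast? R t)) ⟩
      #blocks R ∎
      where
      open ≡-Reasoning
      pointwise : ∀ t (t≟t₀ : Dec (t ≡ t₀)) (other? : Dec (r t ≡ false × IsLeast R t)) (least? : Dec (IsLeast R t)) →
                  𝟙 t≟t₀ + 𝟙 other? ≡ 𝟙 least?
      pointwise t (yes refl) (yes (r≡false , _)) _ = ⊥-elim (true≢false (trans (sym (trans (r≡Rt₀ t) (proj₁ part t))) r≡false))
      pointwise t (yes refl) (no _)       (yes _)      = refl
      pointwise t (yes refl) (no _)       (no ¬least)  = ⊥-elim (¬least least)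
      pointwise t (no _)     (yes _)      (yes _)      = refl
      pointwise t (no _)     (yes (_ , l)) (no ¬least) = ⊥-elim (¬least l)
      pointwise t (no _)     (no _)       (no _)       = refl
      pointwise t (no t≢t₀)  (no ¬other)  (yes l)      = ⊥-elim (¬other (¬-not (λ rt≡true →
        t≢t₀ (sym (IsLeast-unique part least l (trans (sym (r≡Rt₀ t)) rt≡true)))) , l))

    Joined : ℕ → BoolRel (suc M) → Set
    Joined B R = IsPartitionInto B R × ¬ IsSingleton R zero

    joined? : ∀ B (R : BoolRel (suc M)) → Dec (Joined B R)
    joined? B R = isPartitionInto? B R ×-dec ¬? (isSingleton? R zero)

    Joined-resp : ∀ {B} {R R′ : BoolRel (suc M)} → R ≗₂ R′ → Joined B R → Joined B R′
    Joined-resp R≗R′ (into , ¬s) = IsPartitionInto-resp R≗R′ into , ¬s ∘ IsSingleton-resp (≗₂-sym R≗R′) zero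

    #blocksWithRow : Vec Bool M → BoolRel M → ℕ
    #blocksWithRow r R = ∑Fin M (λ t → 𝟙 (isLeast? R t ×-dec (r ≟ᵛ tabulate (R t))))

    ∑-#blocksWithRow : ∀ R → ∑ (allRows M) (λ r → #blocksWithRow r R) ≡ #blocks R
    ∑-#blocksWithRow R = trans (∑-comm (allRows M) (allFin M) _) (∑-cong (allFin M) (λ t → begin
      ∑ (allRows M) (λ r → 𝟙 (isLeast? R t ×-dec (r ≟ᵛ tabulate (R t))))
        ≡⟨ ∑-cong (allRows M) (λ r → trans (𝟙-× (isLeast? R t) (r ≟ᵛ tabulate (R t))) (ℕₚ.*-comm (𝟙 (isLeast? R t)) _)) ⟩
      ∑ (allRows M) (λ r → 𝟙 (r ≟ᵛ tabulate (R t)) * 𝟙 (isLeast? R t))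
        ≡⟨ ∑-allRows-𝟙≡ M (tabulate (R t)) (𝟙 (isLeast? R t)) ⟩
      𝟙 (isLeast? R t) ∎))
      where open ≡-Reasoning

    lookup-ext : ∀ {u v : Vec Bool M} → (∀ j → lookup u j ≡ lookup v j) → u ≡ v
    lookup-ext {u} {v} u≗v = trans (sym (Vecₚ.tabulate∘lookup u)) (trans (Vecₚ.tabulate-cong u≗v) (Vecₚ.tabulate∘lookup v))

    𝟙-joined-cases : ∀ B b (r c : Vec Bool M) (R : BoolRel M) →
                     (j? : Dec (Joined B (border b (lookup r) (lookup c) R))) (c≟r : Dec (c ≡ r)) (b≟true : Dec (b ≡ true))
                     (into? : Dec (IsPartitionInto B R)) → 𝟙 j? ≡ 𝟙 c≟r * (𝟙 b≟true * (#blocksWithRow r R * 𝟙 into?))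
    𝟙-joined-cases B b r c R (yes ((part , #≡B) , ¬s)) c≟r b≟true into? with joined⇒ part ¬s
    ... | b≡true , r≡c , partR , t₀ , least , r≡Rt₀ = sym (begin
      𝟙 c≟r * (𝟙 b≟true * (#blocksWithRow r R * 𝟙 into?))
        ≡⟨ cong₂ (λ x y → x * (y * (#blocksWithRow r R * 𝟙 into?))) (𝟙-yes c≟r c≡r) (𝟙-yes b≟true b≡true) ⟩
      1 * (1 * (#blocksWithRow r R * 𝟙 into?))
        ≡⟨ cong₂ (λ x y → 1 * (1 * (x * y))) one-block (𝟙-yes into? into) ⟩
      1 ∎)
      where
      open ≡-Reasoning
      c≡r : c ≡ r
      c≡r = lookup-ext (λ j → sym (r≡c j))
      into : IsPartitionInto B R
      into = partR , trans (sym (#blocks-joined partR least r≡Rt₀))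
        (trans (#blocks-resp (border-cong (sym b≡true) (λ _ → refl) r≡c (λ _ _ → refl))) #≡B)
      one-block : #blocksWithRow r R ≡ 1
      one-block = ∑Fin-𝟙-unique M (λ t → isLeast? R t ×-dec (r ≟ᵛ tabulate (R t))) t₀
        (least , lookup-ext (λ j → trans (r≡Rt₀ j) (sym (Vecₚ.lookup∘tabulate (R t₀) j))))
        (λ t (least′ , r≡Rt) → IsLeast-unique partR least′ least (begin
          R t t₀                   ≡⟨ Vecₚ.lookup∘tabulate (R t) t₀ ⟨
          lookup (tabulate (R t)) t₀ ≡⟨ cong (λ v → lookup v t₀) r≡Rt ⟨
          lookup r t₀              ≡⟨ r≡Rt₀ t₀ ⟩
          R t₀ t₀                  ≡⟨ proj₁ partR t₀ ⟩
          true                     ∎))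
    𝟙-joined-cases B b r c R (no _) (no _)    b≟true      into?     = refl
    𝟙-joined-cases B b r c R (no _) (yes _)   (no _)      into?     = refl
    𝟙-joined-cases B b r c R (no _) (yes _)   (yes _)     (no _)    =
      sym (trans (ℕₚ.*-identityˡ _) (trans (ℕₚ.*-identityˡ _) (ℕₚ.*-zeroʳ (#blocksWithRow r R))))
    𝟙-joined-cases B b r c R (no ¬j) (yes refl) (yes refl) (yes (partR , #≡B)) =
      sym (trans (ℕₚ.*-identityˡ _) (trans (ℕₚ.*-identityˡ _) (trans (ℕₚ.*-identityʳ _)
        (∑-zero (allFin M) _ (λ t → 𝟙-no _ (λ (least , r≡Rt) → ¬j (joined t least r≡Rt)))))))
      where
      joined : ∀ t → IsLeast R t → r ≡ tabulate (R t) → Joined B (border true (lookup r) (lookup r) R)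
      joined t least r≡Rt = (part , trans (#blocks-joined partR least r≡R) #≡B) , ¬s
        where
        r≡R : ∀ j → lookup r j ≡ R t j
        r≡R j = trans (cong (λ v → lookup v j) r≡Rt) (Vecₚ.lookup∘tabulate (R t) j)
        part = proj₁ (joined⇐ partR r≡R)
        ¬s = proj₂ (joined⇐ partR r≡R)

    ∑-joinedHead : ∀ B → ∑ (allMatrices (suc M)) (𝟙 ∘ joined? B ∘ toRel) ≡ B * #partitionsInto M B
    ∑-joinedHead B = begin
      ∑ (allMatrices (suc M)) (𝟙 ∘ joined? B ∘ toRel)
        ≡⟨ ∑-allMatrices-border M (𝟙 ∘ joined? B) (𝟙-resp (joined? B) Joined-resp) ⟩
      ∑ bools (λ b → ∑ (allRows M) (λ r → ∑ (allRows M) (λ c → ∑ (allMatrices M) (λ G →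
        𝟙 (joined? B (border b (lookup r) (lookup c) (toRel G)))))))
        ≡⟨ ∑-cong bools (λ b → ∑-cong (allRows M) (λ r → ∑-cong (allRows M) (λ c → ∑-over-inner b r c))) ⟩
      ∑ bools (λ b → ∑ (allRows M) (λ r → ∑ (allRows M) (λ c → 𝟙 (c ≟ᵛ r) * (𝟙 (b ≟ᵇ true) * Y r))))
        ≡⟨ ∑-cong bools (λ b → ∑-cong (allRows M) (λ r → ∑-allRows-𝟙≡ M r (𝟙 (b ≟ᵇ true) * Y r))) ⟩
      ∑ bools (λ b → ∑ (allRows M) (λ r → 𝟙 (b ≟ᵇ true) * Y r))
        ≡⟨ ∑-cong bools (λ b → ∑-distribˡ-* (allRows M) (𝟙 (b ≟ᵇ true)) Y) ⟩
      ∑ bools (λ b → 𝟙 (b ≟ᵇ true) * ∑ (allRows M) Y)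
        ≡⟨ ∑-bools-𝟙≡ true (∑ (allRows M) Y) ⟩
      ∑ (allRows M) Y
        ≡⟨ ∑-comm (allRows M) (allMatrices M) _ ⟩
      ∑ (allMatrices M) (λ G → ∑ (allRows M) (λ r → #blocksWithRow r (toRel G) * 𝟙 (into? G)))
        ≡⟨ ∑-cong (allMatrices M) (λ G → count-blocks (toRel G) (isPartitionInto? B (toRel G))) ⟩
      ∑ (allMatrices M) (λ G → B * 𝟙 (into? G))
        ≡⟨ ∑-distribˡ-* (allMatrices M) B (𝟙 ∘ into?) ⟩
      B * #partitionsInto M B ∎
      where
      open ≡-Reasoning
      into? = isPartitionInto? B ∘ toRel
      Y : Vec Bool M → ℕ
      Y r = ∑ (allMatrices M) (λ G → #blocksWithRow r (toRel G) * 𝟙 (into? G))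
      ∑-over-inner : ∀ b r c → ∑ (allMatrices M) (λ G → 𝟙 (joined? B (border b (lookup r) (lookup c) (toRel G)))) ≡
                     𝟙 (c ≟ᵛ r) * (𝟙 (b ≟ᵇ true) * Y r)
      ∑-over-inner b r c =
        trans (∑-cong (allMatrices M) (λ G → 𝟙-joined-cases B b r c (toRel G) _ (c ≟ᵛ r) (b ≟ᵇ true) (into? G)))
        (trans (∑-distribˡ-* (allMatrices M) (𝟙 (c ≟ᵛ r)) _)
               (cong (𝟙 (c ≟ᵛ r) *_) (∑-distribˡ-* (allMatrices M) (𝟙 (b ≟ᵇ true)) _)))
      count-blocks : ∀ R (into? : Dec (IsPartitionInto B R)) →
                     ∑ (allRows M) (λ r → #blocksWithRow r R * 𝟙 into?) ≡ B * 𝟙 into?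
      count-blocks R (yes (_ , #≡B)) = trans (∑-cong (allRows M) (λ r → ℕₚ.*-identityʳ _))
                                             (trans (∑-#blocksWithRow R) (trans #≡B (sym (ℕₚ.*-identityʳ B))))
      count-blocks R (no _) = trans (∑-zero (allRows M) _ (λ r → ℕₚ.*-zeroʳ (#blocksWithRow r R))) (sym (ℕₚ.*-zeroʳ B))

module DiagonalAndPascal where

  open import Defs
  open PrescribedSingletons
  open PartitionsIntoBlocks
  open BinomialExpansion using (sumTo)
  open Touchard using (stirling₂; bell)
  open import Function using (_∘_)
  open import Data.Nat using (ℕ; zero; suc; _+_; _*_; s≤s; _≟_)
  import Data.Nat.Properties as ℕₚ
  open import Data.Fin using (zero; suc; toℕ)
  import Data.Fin.Properties as Finₚ
  open import Data.List as List using (List)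
  import Data.List.Properties as Listₚ
  open import Data.Product using (_,_; proj₁)
  open import Data.Unit using (tt)
  open import Data.Integer as ℤ using (ℤ; +_)
  import Data.Integer.Properties as ℤₚ
  open import Relation.Nullary using (_×-dec_)
  open import Relation.Binary.PropositionalEquality

  #partitionsInto-suc : ∀ M B → #partitionsInto (suc M) B ≡
    ∑ (allMatrices M) (λ G → 𝟙 (isPartition? (toRel G) ×-dec (suc (#blocks (toRel G)) ≟ B))) + B * #partitionsInto M B
  #partitionsInto-suc M B = begin
    ∑ (allMatrices (suc M)) (𝟙 ∘ isPartitionInto? B ∘ toRel)
      ≡⟨ ∑-cong (allMatrices (suc M)) (λ V → 𝟙-split (isPartitionInto? B (toRel V)) (isSingleton? (toRel V) zero)) ⟩
    ∑ (allMatrices (suc M)) (λ V → 𝟙 (isPartitionInto? B (toRel V) ×-dec isSingleton? (toRel V) zero) + 𝟙 (joined? B (toRel V)))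
      ≡⟨ ∑-distrib-+ (allMatrices (suc M)) _ _ ⟩
    ∑ (allMatrices (suc M)) (λ V → 𝟙 (isPartitionInto? B (toRel V) ×-dec isSingleton? (toRel V) zero)) +
    ∑ (allMatrices (suc M)) (𝟙 ∘ joined? B ∘ toRel)
      ≡⟨ cong₂ _+_ (∑-isolatedHead M B) (∑-joinedHead {M} B) ⟩
    ∑ (allMatrices M) (λ G → 𝟙 (isPartition? (toRel G) ×-dec (suc (#blocks (toRel G)) ≟ B))) + B * #partitionsInto M B ∎
    where
    open ≡-Reasoning
    open JoinedHead

  #partitionsInto≡stirling₂ : ∀ n B → #partitionsInto n B ≡ stirling₂ n B
  #partitionsInto≡stirling₂ zero    zero    = #partitionsInto-empty 0
  #partitionsInto≡stirling₂ zero    (suc B) = #partitionsInto-empty (suc B)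
  #partitionsInto≡stirling₂ (suc n) zero    =
    trans (#partitionsInto-suc n 0) (trans (ℕₚ.+-identityʳ _) (∑-zero (allMatrices n) _ (λ G → 𝟙-no _ (λ ()))))
  #partitionsInto≡stirling₂ (suc n) (suc B) = trans (#partitionsInto-suc n (suc B)) (cong₂ _+_
    (trans (∑-cong (allMatrices n) (λ G → 𝟙-cong (λ (part , eq) → part , ℕₚ.suc-injective eq) (λ (part , eq) → part , cong suc eq) _ _))
           (#partitionsInto≡stirling₂ n B))
    (cong (suc B *_) (#partitionsInto≡stirling₂ n (suc B))))

  #admissible-free≡#partitions : ∀ n → #admissible n (λ _ → free) ≡ #partitions n
  #admissible-free≡#partitions n = ∑-cong (allMatrices n) (λ V → 𝟙-cong proj₁ (_, λ _ → tt) _ _)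

  -- A k k counts the partitions of k + 1 elements in which the last one is a singleton.
  A-diag≡#partitions : ∀ k → A k k ≡ #partitions k
  A-diag≡#partitions k = begin
    A k k
      ≡⟨ A≡#admissible {k} {k} ℕₚ.≤-refl ⟩
    #admissible (suc k) (largestSingleton k ∘ toℕ)
      ≡⟨ #admissible-cong (suc k) (λ i → sym (insertAt-single-free (ℕₚ.≤-pred (Finₚ.toℕ<n i)))) ⟩
    #admissible (suc k) (insertAt single (λ _ → free) k ∘ toℕ)
      ≡⟨ #admissible-insertAt (suc k) single (λ _ → free) k (ℕₚ.n<1+n k) ⟩
    #admissible (suc k) (insertAt single (λ _ → free) 0 ∘ toℕ)
      ≡⟨ #admissible-cong (suc k) (λ { zero → refl ; (suc i) → refl }) ⟩
    #admissible (suc k) (single ∷ᶜ (λ _ → free))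
      ≡⟨ #admissible-single k (λ _ → free) ⟩
    #admissible k (λ _ → free)
      ≡⟨ #admissible-free≡#partitions k ⟩
    #partitions k ∎
    where open ≡-Reasoning

  ∑-upTo≡sumTo : ∀ N (f : ℕ → ℕ) → + ∑ (List.upTo N) f ≡ sumTo N (+_ ∘ f)
  ∑-upTo≡sumTo zero    f = refl
  ∑-upTo≡sumTo (suc N) f = begin
    + (f 0 + ∑ (List.applyUpTo suc N) f)         ≡⟨ ℤₚ.pos-+ (f 0) _ ⟩
    + f 0 ℤ.+ + ∑ (List.applyUpTo suc N) f       ≡⟨ cong (λ xs → + f 0 ℤ.+ + ∑ xs f) (sym (Listₚ.map-upTo suc N)) ⟩
    + f 0 ℤ.+ + ∑ (List.map suc (List.upTo N)) f ≡⟨ cong (λ n → + f 0 ℤ.+ + n) (∑-map suc (List.upTo N) f) ⟩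
    + f 0 ℤ.+ + ∑ (List.upTo N) (f ∘ suc)        ≡⟨ cong (ℤ._+_ (+ f 0)) (∑-upTo≡sumTo N (f ∘ suc)) ⟩
    + f 0 ℤ.+ sumTo N (+_ ∘ f ∘ suc)             ∎
    where open ≡-Reasoning

  A-diag≡bell : ∀ k → + A k k ≡ bell k
  A-diag≡bell k = begin
    + A k k                                          ≡⟨ cong +_ (A-diag≡#partitions k) ⟩
    + #partitions k                                  ≡⟨ cong +_ (#partitions≡∑#partitionsInto k) ⟩
    + ∑ (List.upTo (suc k)) (#partitionsInto k)      ≡⟨ cong +_ (∑-cong (List.upTo (suc k)) (#partitionsInto≡stirling₂ k)) ⟩
    + ∑ (List.upTo (suc k)) (stirling₂ k)            ≡⟨ ∑-upTo≡sumTo (suc k) (stirling₂ k) ⟩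
    bell k                                           ∎
    where open ≡-Reasoning

  -- Split on whether the first element is a singleton. If it is, removing it leaves the constraints for
  -- largest singleton k; if it is not, moving it to position k + 1 gives those same constraints.
  A-pascal : ∀ k N → A (N + suc k) (suc k) ≡ A (N + k) k + A (suc N + k) k
  A-pascal k N = begin
    A (N + suc k) (suc k)
      ≡⟨ A≡#admissible (ℕₚ.m≤n+m (suc k) N) ⟩
    #admissible (suc (N + suc k)) (largestSingleton (suc k) ∘ toℕ)
      ≡⟨ cong (λ n → #admissible (suc n) (largestSingleton (suc k) ∘ toℕ)) (ℕₚ.+-suc N k) ⟩
    #admissible (suc L) (largestSingleton (suc k) ∘ toℕ)
      ≡⟨ #admissible-cong (suc L) (λ { zero → refl ; (suc i) → refl }) ⟩
    #admissible (suc L) (free ∷ᶜ ℓ)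
      ≡⟨ #admissible-free L ℓ ⟩
    #admissible (suc L) (single ∷ᶜ ℓ) + #admissible (suc L) (shared ∷ᶜ ℓ)
      ≡⟨ cong₂ _+_ (#admissible-single L ℓ) shared-head ⟩
    #admissible L ℓ + #admissible (suc L) (largestSingleton k ∘ toℕ)
      ≡⟨ cong₂ _+_ (A≡#admissible (ℕₚ.m≤n+m k N)) (A≡#admissible (ℕₚ.m≤n⇒m≤1+n (ℕₚ.m≤n+m k N))) ⟨
    A (N + k) k + A (suc N + k) k ∎
    where
    open ≡-Reasoning
    L = suc (N + k)
    ℓ = largestSingleton k ∘ toℕ
    shared-head : #admissible (suc L) (shared ∷ᶜ ℓ) ≡ #admissible (suc L) (largestSingleton k ∘ toℕ)
    shared-head = begin
      #admissible (suc L) (shared ∷ᶜ ℓ)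
        ≡⟨ #admissible-cong (suc L) (λ { zero → refl ; (suc i) → refl }) ⟩
      #admissible (suc L) (insertAt shared (largestSingleton k) 0 ∘ toℕ)
        ≡⟨ #admissible-insertAt (suc L) shared (largestSingleton k) (suc k) (s≤s (s≤s (ℕₚ.m≤n+m k N))) ⟨
      #admissible (suc L) (insertAt shared (largestSingleton k) (suc k) ∘ toℕ)
        ≡⟨ #admissible-cong (suc L) (insertAt-shared-largestSingleton k ∘ toℕ) ⟩
      #admissible (suc L) (largestSingleton k ∘ toℕ) ∎

open import Defs
open import Data.Nat using (ℕ; _+_; _*_; _^_)
open import Data.Nat.Primality using (Prime)
open import Data.Integer using (ℤ; +_; _-_)
open import Data.Integer.Divisibility using (_∣_)
import Data.Nat.Properties as ℕₚ
import Data.Integer as ℤ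
import Data.Integer.Properties as ℤₚ
open import Data.Integer.Divisibility.Signed using (∣⇒∣ᵤ)
open import Relation.Binary.PropositionalEquality using (cong; cong₂; trans; sym)
open Congruence using (module Modulo)
open Touchard using (module BellArray)
open DiagonalAndPascal using (A-pascal; A-diag≡bell)

theorem4p3 : (p : ℕ) → Prime p → (n m k : ℕ) →
    (+ p) ∣ ((+ A (n + p ^ m + k) k) - (+ (m * A (n + k) k + A (n + k + 1) k)))
theorem4p3 p p-prime n m k = ∣⇒∣ᵤ (divides-difference (begin
  + A (n + p ^ m + k) k                                  ≈⟨ a-+pᵐ m n k ⟩
  + m ℤ.* + A (n + k) k ℤ.+ + A (1 + n + k) k
    ≡⟨ cong₂ ℤ._+_ (sym (ℤₚ.pos-* m _)) (cong (λ i → + A i k) (ℕₚ.+-comm 1 (n + k))) ⟩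
  + (m * A (n + k) k) ℤ.+ + A (n + k + 1) k              ≡⟨ sym (ℤₚ.pos-+ (m * A (n + k) k) _) ⟩
  + (m * A (n + k) k + A (n + k + 1) k)                  ∎))
  where
  open Modulo p using (divides-difference; module ≈-Reasoning)
  open ≈-Reasoning
  open BellArray p-prime (λ k N → A (N + k) k) A-pascal A-diag≡bell
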